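{- Let $C$ be a $2$-dimensional hypercut over $\mathbb{F}_2$ on vertex set $[n]$, let $x\in[n]$, let $G=\mathrm{link}_x(C)$ with vertex set $V=[n]\setminus\{x\}$, and let $\bar G$ be its complement on $V$. Let $S\subseteq V$ and let $G'$ be the graph obtained from $\bar G$ by deleting the vertices of $S$. Then for every nonempty $S$-atom $A\subseteq V\setminus S$, at least $|A|-2$ edges of $G'$ meet $A$.
   Context: A $2$-dimensional hypercut over $\mathbb{F}_2$ on $[n]$ is an inclusion-minimal set of triples meeting every maximal $\mathbb{F}_2$-acyclic set of triples (a set of triples is acyclic if the indicator vectors of their boundaries $\{ab,bc,ac\}$ are linearly independent over $\mathbb{F}_2$). $\mathrm{link}_x(C)$ is the graph on $[n]\setminus\{x\}$ whose edges are the pairs $\{a,b\}$ with $\{x,a,b\}\in C$. For $S\subseteq V$, an $S$-atom is a set $A\subseteq V$ such that for all $u,u'\in A$ and $v\in S$: $uv\in E(\bar G)$ if and only if $u'v\in E(\bar G)$. -}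

module Defs where

open import Data.Nat using (ℕ; _<ᵇ_; _≥_; _∸_)
open import Data.Bool using (Bool; true; false; if_then_else_; _∧_; _xor_)
open import Data.Fin using (Fin; toℕ)
open import Data.Fin.Subset using (Subset; _∈_; _∉_; ∣_∣)
open import Data.List using (List; foldr; length)
open import Data.List.Relation.Unary.All using (All)
open import Data.List.Relation.Unary.Unique.Propositional using (Unique)
open import Data.Fin using () renaming (_<_ to _<F_)
open import Data.List using (allFin)
open import Data.Product using (Σ; ∃; _×_; _,_)
open import Data.Sum using (_⊎_)
open import Relation.Binary.PropositionalEquality using (_≡_; _≢_)
open import Relation.Nullary using (¬_)

-- A set of triples on [n] = Fin n is a Bool-valued function on ordered
-- triples; only its values at strictly increasing triples a<b<c matter:
-- the triple {a,b,c} (a<b<c) belongs to T iff T a b c ≡ true.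
TSet : ℕ → Set
TSet n = Fin n → Fin n → Fin n → Bool

module _ {n : ℕ} where

  lt : Fin n → Fin n → Bool
  lt a b = toℕ a <ᵇ toℕ b

  In : TSet n → Fin n → Fin n → Fin n → Set
  In T a b c = (lt a b ∧ lt b c ∧ T a b c) ≡ true

  -- membership of the unordered triple {a,b,c} (false unless a,b,c distinct)
  memT : TSet n → Fin n → Fin n → Fin n → Bool
  memT T a b c =
    if lt a b ∧ lt b c then T a b c
    else if lt a c ∧ lt c b then T a c b
    else if lt b a ∧ lt a c then T b a c
    else if lt b c ∧ lt c a then T b c a
    else if lt c a ∧ lt a b then T c a b
    else if lt c b ∧ lt b a then T c b a
    else false

  _⊆T_ : TSet n → TSet n → Set
  T ⊆T T' = ∀ a b c → In T a b c → In T' a b c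

  NonemptyT : TSet n → Set
  NonemptyT T = Σ (Fin n) λ a → Σ (Fin n) λ b → Σ (Fin n) λ c → In T a b c

  -- coefficient of the edge {a,b} in the F2-sum of the boundaries of the
  -- triples of U (parity of the number of triples of U containing a and b)
  edgeParity : TSet n → Fin n → Fin n → Bool
  edgeParity U a b = foldr (λ c acc → memT U a b c xor acc) false (allFin n)

  BoundaryZero : TSet n → Set
  BoundaryZero U = ∀ a b → edgeParity U a b ≡ false

  -- boundary vectors of T linearly independent over F2:
  -- no nonempty subset has boundaries summing to zero
  Acyclic : TSet n → Set
  Acyclic T = ∀ U → U ⊆T T → BoundaryZero U → ¬ NonemptyT U

  MaxAcyclic : TSet n → Set
  MaxAcyclic T = Acyclic T × (∀ T' → T ⊆T T' → Acyclic T' → T' ⊆T T)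

  Meets : TSet n → TSet n → Set
  Meets C T = Σ (Fin n) λ a → Σ (Fin n) λ b → Σ (Fin n) λ c → In C a b c × In T a b c

  MeetsAllMaxAcyclic : TSet n → Set
  MeetsAllMaxAcyclic C = ∀ T → MaxAcyclic T → Meets C T

  Hypercut : TSet n → Set
  Hypercut C = MeetsAllMaxAcyclic C × (∀ C' → C' ⊆T C → MeetsAllMaxAcyclic C' → C ⊆T C')

  -- edge relation of the complement of link_x(C) on V = [n] \ {x}
  CoLinkAdj : TSet n → Fin n → Fin n → Fin n → Set
  CoLinkAdj C x a b = (a ≢ x) × (b ≢ x) × (a ≢ b) × (memT C x a b ≡ false)

  IsAtom : TSet n → Fin n → Subset n → Subset n → Set
  IsAtom C x S A = ∀ u u' v → u ∈ A → u' ∈ A → v ∈ S →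
                   (CoLinkAdj C x u v → CoLinkAdj C x u' v) × (CoLinkAdj C x u' v → CoLinkAdj C x u v)

  EdgeG'MeetingA : TSet n → Fin n → Subset n → Subset n → Fin n × Fin n → Set
  EdgeG'MeetingA C x S A (a , b) =
    (a <F b) × CoLinkAdj C x a b × (a ∉ S) × (b ∉ S) × ((a ∈ A) ⊎ (b ∈ A))

module Submission where

-- Counting: each edge meeting A merges at most two colour classes, so if
-- fewer than |A| - 2 edges meet A, then A carries a colouring with three
-- colours, all used, in which every edge of G′ is monochromatic (vertices
-- outside A stay uncoloured).  Such a colouring is impossible, by three facts
-- about the binary matroid whose independent sets are the acyclic sets:
--   * a hypercut never meets a cycle in exactly one triple, nor a cycle of
--     four triples in exactly three (fundamental cycles, basis exchange);
--     hence it meets the boundary of every tetrahedron evenly;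
--   * a cycle is orthogonal to every coboundary, so a nonempty coboundary
--     meets every basis, and by minimality contains any hypercut inside it.
-- With u₀, u₁, u₂ of colours 0, 1, 2, let D be the set of pairs coloured 0
-- and 1.  The tetrahedron parity, together with the atom property of A for
-- vertices in S, places the coboundary δD inside C, hence C ⊆ δD; yet the
-- triple x u₀ u₂ lies in C and not in δD.

open import Defs
open import Algebra.Bundles using (CommutativeMonoid; CommutativeRing)
import Algebra.Properties.CommutativeSemigroup as CommSemigroupProperties
open import Data.Bool using (Bool; true; false; _∧_; _∨_; _xor_; not; T)
import Data.Bool as Bool
open import Data.Bool.Properties
  using ( xor-∧-commutativeRing; ∧-commutativeMonoid; xor-identityʳ; xor-same; xor-comm
        ; ∧-comm; ∧-assoc; ∧-zeroʳ; ∧-identityʳ; ∧-distribˡ-xor; ∨-zeroʳ )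
open import Data.Empty using (⊥; ⊥-elim)
open import Data.Fin using (Fin; zero; suc; toℕ; _≟_; punchIn; punchOut) renaming (_<_ to _<F_)
open import Data.Fin.Properties
  using (toℕ-injective; any?; punchInᵢ≢i; punchOut-cong; punchOut-punchIn) renaming (_<?_ to _<F?_)
open import Data.Fin.Subset using (Subset; _∈_; _∉_; ∣_∣; inside; outside)
open import Data.Fin.Subset.Properties using (_∈?_)
open import Data.List using (List; []; _∷_; foldr; tabulate; allFin; cartesianProduct; filter; length)
open import Data.List.Membership.Propositional using () renaming (_∈_ to _∈ˡ_)
open import Data.List.Membership.Propositional.Properties using (∈-filter⁺; ∈-allFin; ∈-cartesianProduct⁺)
open import Data.List.Properties using (filter-accept; filter-reject)
open import Data.List.Relation.Unary.All as All using (All; []; _∷_)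
open import Data.List.Relation.Unary.All.Properties using (all-filter) renaming (filter⁺ to all-filter⁺)
open import Data.List.Relation.Unary.Any using (here; there)
open import Data.List.Relation.Unary.Unique.Propositional using (Unique)
open import Data.List.Relation.Unary.Unique.Propositional.Properties
  using (cartesianProduct⁺; allFin⁺) renaming (filter⁺ to unique-filter⁺)
open import Data.Maybe using (Maybe; just; nothing; _>>=_)
open import Data.Maybe.Properties using (just-injective)
open import Data.Nat as ℕ using (ℕ; zero; suc; _≤_; _≥_; _∸_; z≤n; s≤s; _≤?_)
import Data.Nat.Properties as ℕₚ
open ℕₚ using (≤-refl; ≤-trans; m≤n⇒m∸n≡0; ≰⇒>)
open import Data.Product using (Σ; _×_; _,_; proj₁; proj₂)
open import Data.Product.Properties using (≡-dec)
open import Data.Sum using (_⊎_; inj₁; inj₂)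
open import Data.Unit using (tt)
open import Data.Vec using ([]; _∷_)
open Data.Vec._[_]=_ using (here; there)
open import Function using (_∘_; id)
open import Relation.Binary.Definitions using (tri<; tri≈; tri>)
open import Relation.Binary.PropositionalEquality
open import Relation.Nullary using (¬_; Dec; does; yes; no)
open import Relation.Nullary.Decidable using (_×-dec_; _⊎-dec_; ¬?)
open import Relation.Unary using (Decidable)

module Xor = CommSemigroupProperties
  (CommutativeMonoid.commutativeSemigroup (CommutativeRing.+-commutativeMonoid xor-∧-commutativeRing))
module And = CommSemigroupProperties (CommutativeMonoid.commutativeSemigroup ∧-commutativeMonoid)

true≢false : ∀ {b : Bool} → b ≡ true → b ≡ false → ⊥
true≢false refl ()

true-or-false : (b : Bool) → b ≡ true ⊎ b ≡ false
true-or-false true  = inj₁ refl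
true-or-false false = inj₂ refl

not-true : ∀ {b : Bool} → ¬ b ≡ true → b ≡ false
not-true {true}  ¬t = ⊥-elim (¬t refl)
not-true {false} ¬t = refl

∧-true : ∀ {x y} → (x ∧ y) ≡ true → x ≡ true × y ≡ true
∧-true {true} {true} _ = refl , refl

∧-split : ∀ {x y z} → (x ∧ (y ∧ z)) ≡ true → (x ∧ y) ≡ true × z ≡ true
∧-split {true} {true} {true} _ = refl , refl

∧-join : ∀ {x y z} → (x ∧ y) ≡ true → z ≡ true → (x ∧ (y ∧ z)) ≡ true
∧-join {true} {true} refl refl = refl

⨁ : (m : ℕ) → (Fin m → Bool) → Bool
⨁ zero    f = false
⨁ (suc m) f = f zero xor ⨁ m (f ∘ suc)

⨁-cong : ∀ m {f g : Fin m → Bool} → (∀ a → f a ≡ g a) → ⨁ m f ≡ ⨁ m g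
⨁-cong zero    e = refl
⨁-cong (suc m) e = cong₂ _xor_ (e zero) (⨁-cong m (e ∘ suc))

⨁-xor : ∀ m (f g : Fin m → Bool) → ⨁ m (λ a → f a xor g a) ≡ ⨁ m f xor ⨁ m g
⨁-xor zero    f g = refl
⨁-xor (suc m) f g =
  trans (cong ((f zero xor g zero) xor_) (⨁-xor m (f ∘ suc) (g ∘ suc))) (Xor.interchange (f zero) (g zero) (⨁ m (f ∘ suc)) (⨁ m (g ∘ suc)))

⨁-zero : ∀ m {f : Fin m → Bool} → (∀ a → f a ≡ false) → ⨁ m f ≡ false
⨁-zero zero    e = refl
⨁-zero (suc m) e rewrite e zero = ⨁-zero m (e ∘ suc)

⨁-scale : ∀ m b (f : Fin m → Bool) → ⨁ m (λ a → b ∧ f a) ≡ b ∧ ⨁ m f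
⨁-scale m false f = ⨁-zero m (λ _ → refl)
⨁-scale m true  f = refl

⨁-swap : ∀ m k (f : Fin m → Fin k → Bool) →
         ⨁ m (λ a → ⨁ k (f a)) ≡ ⨁ k (λ b → ⨁ m (λ a → f a b))
⨁-swap zero    k f = sym (⨁-zero k (λ _ → refl))
⨁-swap (suc m) k f =
  trans (cong (⨁ k (f zero) xor_) (⨁-swap m k (f ∘ suc))) (sym (⨁-xor k (f zero) _))

eqb : ∀ {m} → Fin m → Fin m → Bool
eqb a b = does (a ≟ b)

eqb-refl : ∀ {m} (a : Fin m) → eqb a a ≡ true
eqb-refl a with a ≟ a
... | yes _ = refl
... | no ¬p = ⊥-elim (¬p refl)

eqb-sound : ∀ {m} {a b : Fin m} → eqb a b ≡ true → a ≡ b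
eqb-sound {a = a} {b} e with a ≟ b
... | yes p = p

eqb-distinct : ∀ {m} {a b : Fin m} → ¬ a ≡ b → eqb a b ≡ false
eqb-distinct {a = a} {b} ¬p with a ≟ b
... | yes p = ⊥-elim (¬p p)
... | no _  = refl

eqb-sym : ∀ {m} (a b : Fin m) → eqb a b ≡ eqb b a
eqb-sym a b with a ≟ b | b ≟ a
... | yes _ | yes _ = refl
... | no _  | no _  = refl
... | yes p | no ¬q = ⊥-elim (¬q (sym p))
... | no ¬p | yes q = ⊥-elim (¬p (sym q))

⨁-delta : ∀ m (p : Fin m) (g : Fin m → Bool) → ⨁ m (λ a → eqb a p ∧ g a) ≡ g p
⨁-delta (suc m) zero    g = trans (cong (g zero xor_) (⨁-zero m (λ _ → refl))) (xor-identityʳ (g zero))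
⨁-delta (suc m) (suc p) g = ⨁-delta m p (g ∘ suc)

⨁-point : ∀ m (p : Fin m) → ⨁ m (λ a → eqb a p) ≡ true
⨁-point m p = trans (⨁-cong m (λ a → sym (∧-identityʳ (eqb a p)))) (⨁-delta m p (λ _ → true))

foldr-tabulate : ∀ m {A : Set} (h : Fin m → A) (f : A → Bool) →
                 foldr (λ c acc → f c xor acc) false (tabulate h) ≡ ⨁ m (f ∘ h)
foldr-tabulate zero    h f = refl
foldr-tabulate (suc m) h f = cong (f (h zero) xor_) (foldr-tabulate m (h ∘ suc) f)

edgeParity-⨁ : ∀ {n} (U : TSet n) a b → edgeParity U a b ≡ ⨁ n (memT U a b)
edgeParity-⨁ {n} U a b = foldr-tabulate n id (memT U a b)

module _ {n : ℕ} where

  lt-complete : (a b : Fin n) → toℕ a ℕ.< toℕ b → lt a b ≡ true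
  lt-complete a b p with lt a b in e
  ... | true  = refl
  ... | false = ⊥-elim (subst T e (ℕₚ.<⇒<ᵇ p))

  lt-sound : (a b : Fin n) → lt a b ≡ true → toℕ a ℕ.< toℕ b
  lt-sound a b e = ℕₚ.<ᵇ⇒< (toℕ a) (toℕ b) (subst T (sym e) tt)

  lt-false : (a b : Fin n) → toℕ b ℕ.≤ toℕ a → lt a b ≡ false
  lt-false a b b≤a with lt a b in e
  ... | true  = ⊥-elim (ℕₚ.≤⇒≯ b≤a (lt-sound a b e))
  ... | false = refl

  lt-irrefl : (a : Fin n) → lt a a ≡ false
  lt-irrefl a = lt-false a a ℕₚ.≤-refl

  lt-asym : (a b : Fin n) → lt a b ≡ true → lt b a ≡ false
  lt-asym a b e = lt-false b a (ℕₚ.<⇒≤ (lt-sound a b e))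

  lt-trans : (a b c : Fin n) → lt a b ≡ true → lt b c ≡ true → lt a c ≡ true
  lt-trans a b c e f = lt-complete a c (ℕₚ.<-trans (lt-sound a b e) (lt-sound b c f))

  data Compare (a b : Fin n) : Set where
    less    : lt a b ≡ true  → lt b a ≡ false → Compare a b
    equal   : a ≡ b → Compare a b
    greater : lt a b ≡ false → lt b a ≡ true  → Compare a b

  compare : (a b : Fin n) → Compare a b
  compare a b with ℕₚ.<-cmp (toℕ a) (toℕ b)
  ... | tri< p _ _ = less (lt-complete a b p) (lt-asym a b (lt-complete a b p))
  ... | tri≈ _ e _ = equal (toℕ-injective e)
  ... | tri> _ _ p = greater (lt-asym b a (lt-complete b a p)) (lt-complete b a p)

module _ {n : ℕ} where

  record Ascending (p q r : Fin n) : Set where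
    field
      p<q : lt p q ≡ true
      q<r : lt q r ≡ true
      p<r : lt p r ≡ true
      q≮p : lt q p ≡ false
      r≮q : lt r q ≡ false
      r≮p : lt r p ≡ false
  open Ascending

  ascending : (p q r : Fin n) → lt p q ≡ true → lt q r ≡ true → Ascending p q r
  ascending p q r e f = record
    { p<q = e ; q<r = f ; p<r = lt-trans p q r e f
    ; q≮p = lt-asym p q e ; r≮q = lt-asym q r f ; r≮p = lt-asym p r (lt-trans p q r e f) }

  data Arrangement (p q r : Fin n) : Fin n → Fin n → Fin n → Set where
    pqr : Arrangement p q r p q r
    prq : Arrangement p q r p r q
    qpr : Arrangement p q r q p r
    qrp : Arrangement p q r q r p
    rpq : Arrangement p q r r p q
    rqp : Arrangement p q r r q p

  swap₁₂ : ∀ {p q r a b c} → Arrangement p q r a b c → Arrangement p q r b a c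
  swap₁₂ pqr = qpr
  swap₁₂ prq = rpq
  swap₁₂ qpr = pqr
  swap₁₂ qrp = rqp
  swap₁₂ rpq = prq
  swap₁₂ rqp = qrp

  swap₂₃ : ∀ {p q r a b c} → Arrangement p q r a b c → Arrangement p q r a c b
  swap₂₃ pqr = prq
  swap₂₃ prq = pqr
  swap₂₃ qpr = qrp
  swap₂₃ qrp = qpr
  swap₂₃ rpq = rqp
  swap₂₃ rqp = rpq

  _on_ : Fin n → Fin n × Fin n × Fin n → Set
  y on (a , b , c) = y ≡ a ⊎ (y ≡ b ⊎ y ≡ c)

  arranged-on : ∀ {p q r a b c y} → Arrangement p q r a b c → y on (a , b , c) → y on (p , q , r)
  arranged-on pqr m = m
  arranged-on prq (inj₁ e) = inj₁ e
  arranged-on prq (inj₂ (inj₁ e)) = inj₂ (inj₂ e)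
  arranged-on prq (inj₂ (inj₂ e)) = inj₂ (inj₁ e)
  arranged-on qpr (inj₁ e) = inj₂ (inj₁ e)
  arranged-on qpr (inj₂ (inj₁ e)) = inj₁ e
  arranged-on qpr (inj₂ (inj₂ e)) = inj₂ (inj₂ e)
  arranged-on qrp (inj₁ e) = inj₂ (inj₁ e)
  arranged-on qrp (inj₂ (inj₁ e)) = inj₂ (inj₂ e)
  arranged-on qrp (inj₂ (inj₂ e)) = inj₁ e
  arranged-on rpq (inj₁ e) = inj₂ (inj₂ e)
  arranged-on rpq (inj₂ (inj₁ e)) = inj₁ e
  arranged-on rpq (inj₂ (inj₂ e)) = inj₂ (inj₁ e)
  arranged-on rqp (inj₁ e) = inj₂ (inj₂ e)
  arranged-on rqp (inj₂ (inj₁ e)) = inj₂ (inj₁ e)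
  arranged-on rqp (inj₂ (inj₂ e)) = inj₁ e

  Coincident : Fin n → Fin n → Fin n → Set
  Coincident a b c = a ≡ b ⊎ (b ≡ c ⊎ a ≡ c)

  data Shape (a b c : Fin n) : Set where
    coincident : Coincident a b c → Shape a b c
    arranged   : ∀ {p q r} → Ascending p q r → Arrangement p q r a b c → Shape a b c

  shape : (a b c : Fin n) → Shape a b c
  shape a b c with compare a b
  ... | equal e = coincident (inj₁ e)
  shape a b c | less ab _ with compare b c
  ...   | equal e = coincident (inj₂ (inj₁ e))
  ...   | less bc _ = arranged (ascending a b c ab bc) pqr
  ...   | greater _ cb with compare a c
  ...     | equal e = coincident (inj₂ (inj₂ e))
  ...     | less ac _ = arranged (ascending a c b ac cb) prq
  ...     | greater _ ca = arranged (ascending c a b ca ab) qrp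
  shape a b c | greater _ ba with compare a c
  ...   | equal e = coincident (inj₂ (inj₂ e))
  ...   | less ac _ = arranged (ascending b a c ba ac) qpr
  ...   | greater _ ca with compare b c
  ...     | equal e = coincident (inj₂ (inj₁ e))
  ...     | less bc _ = arranged (ascending b c a bc ca) rpq
  ...     | greater _ cb = arranged (ascending c b a cb ba) rqp

  memT-arranged : ∀ (U : TSet n) {p q r a b c} → Ascending p q r → Arrangement p q r a b c →
                  memT U a b c ≡ U p q r
  memT-arranged U s pqr rewrite p<q s | q<r s = refl
  memT-arranged U s prq rewrite p<r s | r≮q s | p<q s | q<r s = refl
  memT-arranged U s qpr rewrite q≮p s | q<r s | r≮p s | p<q s = refl
  memT-arranged U s qrp rewrite q<r s | r≮p s | q≮p s | r≮q s | p<q s = refl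
  memT-arranged U s rpq rewrite r≮p s | r≮q s | p<r s | p<q s | q<r s = refl
  memT-arranged U s rqp rewrite r≮q s | r≮p s | q<r s | q≮p s | p<r s | p<q s = refl

  memT-coincident : ∀ (U : TSet n) {a b c} → Coincident a b c → memT U a b c ≡ false
  memT-coincident U {a} {_} {c} (inj₁ refl) with compare a c
  ... | less ac ca rewrite lt-irrefl a | ac | ca = refl
  ... | equal refl rewrite lt-irrefl a = refl
  ... | greater ac ca rewrite lt-irrefl a | ac | ca = refl
  memT-coincident U {a} {b} (inj₂ (inj₁ refl)) with compare a b
  ... | less ab ba rewrite lt-irrefl b | ab | ba = refl
  ... | equal refl rewrite lt-irrefl a = refl
  ... | greater ab ba rewrite lt-irrefl b | ab | ba = refl
  memT-coincident U {a} {b} (inj₂ (inj₂ refl)) with compare a b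
  ... | less ab ba rewrite lt-irrefl a | ab | ba = refl
  ... | equal refl rewrite lt-irrefl a = refl
  ... | greater ab ba rewrite lt-irrefl a | ab | ba = refl

  coincident-swap₁₂ : ∀ {a b c} → Coincident a b c → Coincident b a c
  coincident-swap₁₂ (inj₁ e)        = inj₁ (sym e)
  coincident-swap₁₂ (inj₂ (inj₁ e)) = inj₂ (inj₂ e)
  coincident-swap₁₂ (inj₂ (inj₂ e)) = inj₂ (inj₁ e)

  coincident-swap₂₃ : ∀ {a b c} → Coincident a b c → Coincident a c b
  coincident-swap₂₃ (inj₁ e)        = inj₂ (inj₂ e)
  coincident-swap₂₃ (inj₂ (inj₁ e)) = inj₂ (inj₁ (sym e))
  coincident-swap₂₃ (inj₂ (inj₂ e)) = inj₁ e

  memT-swap₁₂ : ∀ (U : TSet n) a b c → memT U a b c ≡ memT U b a c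
  memT-swap₁₂ U a b c with shape a b c
  ... | coincident κ = trans (memT-coincident U κ) (sym (memT-coincident U (coincident-swap₁₂ κ)))
  ... | arranged s π = trans (memT-arranged U s π) (sym (memT-arranged U s (swap₁₂ π)))

  memT-swap₂₃ : ∀ (U : TSet n) a b c → memT U a b c ≡ memT U a c b
  memT-swap₂₃ U a b c with shape a b c
  ... | coincident κ = trans (memT-coincident U κ) (sym (memT-coincident U (coincident-swap₂₃ κ)))
  ... | arranged s π = trans (memT-arranged U s π) (sym (memT-arranged U s (swap₂₃ π)))

  record Symmetric (f : TSet n) : Set where
    field
      sym₁₂    : ∀ a b c → f a b c ≡ f b a c
      sym₂₃    : ∀ a b c → f a b c ≡ f a c b
      diagonal : ∀ a c → f a a c ≡ false

  module _ {f : TSet n} (σ : Symmetric f) where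
    open Symmetric σ

    symmetric-arranged : ∀ {p q r a b c} → Arrangement p q r a b c → f p q r ≡ f a b c
    symmetric-arranged {p} {q} {r} pqr = refl
    symmetric-arranged {p} {q} {r} prq = sym₂₃ p q r
    symmetric-arranged {p} {q} {r} qpr = sym₁₂ p q r
    symmetric-arranged {p} {q} {r} qrp = trans (sym₁₂ p q r) (sym₂₃ q p r)
    symmetric-arranged {p} {q} {r} rpq = trans (sym₂₃ p q r) (sym₁₂ p r q)
    symmetric-arranged {p} {q} {r} rqp = trans (sym₁₂ p q r) (trans (sym₂₃ q p r) (sym₁₂ q r p))

    symmetric-coincident : ∀ {a b c} → Coincident a b c → f a b c ≡ false
    symmetric-coincident {a} {_} {c} (inj₁ refl)        = diagonal a c
    symmetric-coincident {a} {b} (inj₂ (inj₁ refl)) = trans (sym₁₂ a b b) (trans (sym₂₃ b a b) (diagonal b a))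
    symmetric-coincident {a} {b} (inj₂ (inj₂ refl)) = trans (sym₂₃ a b a) (diagonal a b)

    memT-symmetric : ∀ a b c → memT f a b c ≡ f a b c
    memT-symmetric a b c with shape a b c
    ... | coincident κ = trans (memT-coincident f κ) (sym (symmetric-coincident κ))
    ... | arranged s π = trans (memT-arranged f s π) (symmetric-arranged π)

  inAsc : TSet n → Fin n → Fin n → Fin n → Bool
  inAsc U a b c = lt a b ∧ (lt b c ∧ U a b c)

  memT-split : ∀ (U : TSet n) a b c →
               (lt a b ∧ memT U a b c) ≡ inAsc U a b c xor (inAsc U a c b xor inAsc U c a b)
  memT-split U a b c with shape a b c
  ... | arranged s pqr rewrite memT-arranged U s pqr | p<q s | q<r s | p<r s | r≮q s | r≮p s = sym (xor-identityʳ _)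
  ... | arranged s prq rewrite memT-arranged U s prq | p<q s | q<r s | p<r s | q≮p s | r≮q s = sym (xor-identityʳ _)
  ... | arranged s qpr rewrite memT-arranged U s qpr | q<r s | p<r s | q≮p s | r≮q s | r≮p s = refl
  ... | arranged s qrp rewrite memT-arranged U s qrp | p<q s | q<r s | p<r s | q≮p s | r≮p s = refl
  ... | arranged s rpq rewrite memT-arranged U s rpq | p<q s | q<r s | q≮p s | r≮q s | r≮p s = refl
  ... | arranged s rqp rewrite memT-arranged U s rqp | p<q s | p<r s | q≮p s | r≮q s | r≮p s = refl
  memT-split U a b c | coincident (inj₁ refl) with compare a c
  ... | less ac ca rewrite lt-irrefl a | ac | ca = refl
  ... | equal refl rewrite lt-irrefl a = refl
  ... | greater ac ca rewrite lt-irrefl a | ac | ca = refl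
  memT-split U a b c | coincident (inj₂ (inj₁ refl)) rewrite memT-coincident U {a} {b} {b} (inj₂ (inj₁ refl)) with compare a b
  ... | less ab ba rewrite lt-irrefl b | ab | ba = refl
  ... | equal refl rewrite lt-irrefl a = refl
  ... | greater ab ba rewrite lt-irrefl b | ab | ba = refl
  memT-split U a b c | coincident (inj₂ (inj₂ refl)) rewrite memT-coincident U {a} {b} {a} (inj₂ (inj₂ refl)) with compare a b
  ... | less ab ba rewrite lt-irrefl a | ab | ba = refl
  ... | equal refl rewrite lt-irrefl a = refl
  ... | greater ab ba rewrite lt-irrefl a | ab = refl

  record Sorted (a b c : Fin n) : Set where
    field
      {lo mid hi} : Fin n
      ascends     : Ascending lo mid hi
      arrangement : Arrangement lo mid hi a b c

  sort : (a b c : Fin n) → ¬ a ≡ b → ¬ b ≡ c → ¬ a ≡ c → Sorted a b c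
  sort a b c a≢b b≢c a≢c with shape a b c
  ... | arranged s π = record { ascends = s ; arrangement = π }
  ... | coincident (inj₁ e)        = ⊥-elim (a≢b e)
  ... | coincident (inj₂ (inj₁ e)) = ⊥-elim (b≢c e)
  ... | coincident (inj₂ (inj₂ e)) = ⊥-elim (a≢c e)

  arrangement⁻¹ : ∀ {p q r a b c} → Arrangement p q r a b c → Arrangement a b c p q r
  arrangement⁻¹ pqr = pqr
  arrangement⁻¹ prq = prq
  arrangement⁻¹ qpr = qpr
  arrangement⁻¹ qrp = rpq
  arrangement⁻¹ rpq = qrp
  arrangement⁻¹ rqp = rqp

  on-min : ∀ {p q r z} → Ascending p q r → z on (p , q , r) → z ≡ p ⊎ lt p z ≡ true
  on-min s (inj₁ e)        = inj₁ e
  on-min s (inj₂ (inj₁ refl)) = inj₂ (p<q s)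
  on-min s (inj₂ (inj₂ refl)) = inj₂ (p<r s)

  on-max : ∀ {p q r z} → Ascending p q r → z on (p , q , r) → z ≡ r ⊎ lt z r ≡ true
  on-max s (inj₁ refl)        = inj₂ (p<r s)
  on-max s (inj₂ (inj₁ refl)) = inj₂ (q<r s)
  on-max s (inj₂ (inj₂ e))    = inj₁ e

  private
    irreflexive : ∀ (a : Fin n) → lt a a ≡ true → ⊥
    irreflexive a e = true≢false e (lt-irrefl a)

    middle-point : ∀ {p q r p′ q′ r′} → Ascending p q r → Ascending p′ q′ r′ →
                   p on (p′ , q′ , r′) → q on (p′ , q′ , r′) → r on (p′ , q′ , r′) → q ≡ q′
    middle-point {p} s s′ p-on (inj₁ refl) r-on with on-min s′ p-on
    ... | inj₁ refl = ⊥-elim (irreflexive p (p<q s))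
    ... | inj₂ q<p  = ⊥-elim (true≢false q<p (q≮p s))
    middle-point s s′ p-on (inj₂ (inj₁ e)) r-on = e
    middle-point {q = q} s s′ p-on (inj₂ (inj₂ refl)) r-on with on-max s′ r-on
    ... | inj₁ refl = ⊥-elim (irreflexive q (q<r s))
    ... | inj₂ r<q  = ⊥-elim (true≢false r<q (r≮q s))

    least-point : ∀ {p q r p′ r′} → Ascending p q r → Ascending p′ q r′ → p on (p′ , q , r′) → p ≡ p′
    least-point s s′ (inj₁ e)           = e
    least-point {p} s s′ (inj₂ (inj₁ refl)) = ⊥-elim (irreflexive p (p<q s))
    least-point s s′ (inj₂ (inj₂ refl)) = ⊥-elim (true≢false (p<q s) (r≮q s′))

    greatest-point : ∀ {p q r p′ r′} → Ascending p q r → Ascending p′ q r′ → r on (p′ , q , r′) → r ≡ r′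
    greatest-point s s′ (inj₁ refl)        = ⊥-elim (true≢false (q<r s) (q≮p s′))
    greatest-point {q = q} s s′ (inj₂ (inj₁ refl)) = ⊥-elim (irreflexive q (q<r s))
    greatest-point s s′ (inj₂ (inj₂ e))    = e

  ascending-on : ∀ {p q r p′ q′ r′} → Ascending p q r → Ascending p′ q′ r′ →
                 p on (p′ , q′ , r′) → q on (p′ , q′ , r′) → r on (p′ , q′ , r′) → (p , q , r) ≡ (p′ , q′ , r′)
  ascending-on s s′ p-on q-on r-on with middle-point s s′ p-on q-on r-on
  ... | refl = cong₂ _,_ (least-point s s′ p-on) (cong (_ ,_) (greatest-point s s′ r-on))

module _ {n : ℕ} where

  infix  4 _∈ₜ_ _⊆ₜ_
  infixl 6 _⊹_ _∖_ _⊕_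

  Triple : Set
  Triple = Fin n × Fin n × Fin n

  _≟ₜ_ : (s t : Triple) → Dec (s ≡ t)
  _≟ₜ_ = ≡-dec _≟_ (≡-dec _≟_ _≟_)

  val : TSet n → Triple → Bool
  val U (a , b , c) = U a b c

  Ascends : Triple → Set
  Ascends (a , b , c) = (lt a b ∧ lt b c) ≡ true

  record _∈ₜ_ (t : Triple) (U : TSet n) : Set where
    constructor member
    field
      ascends : Ascends t
      value   : val U t ≡ true
  open _∈ₜ_ public

  _⊆ₜ_ : TSet n → TSet n → Set
  U ⊆ₜ W = ∀ t → t ∈ₜ U → t ∈ₜ W

  In⇒∈ₜ : ∀ {U} a b c → In U a b c → (a , b , c) ∈ₜ U
  In⇒∈ₜ a b c m = member (proj₁ (∧-split {lt a b} {lt b c} m)) (proj₂ (∧-split {lt a b} {lt b c} m))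

  ∈ₜ⇒In : ∀ {U} a b c → (a , b , c) ∈ₜ U → In U a b c
  ∈ₜ⇒In a b c (member s v) = ∧-join {lt a b} {lt b c} s v

  ⊆T⇒⊆ₜ : ∀ {U W : TSet n} → U ⊆T W → U ⊆ₜ W
  ⊆T⇒⊆ₜ s (a , b , c) m = In⇒∈ₜ a b c (s a b c (∈ₜ⇒In a b c m))

  ⊆ₜ⇒⊆T : ∀ {U W : TSet n} → U ⊆ₜ W → U ⊆T W
  ⊆ₜ⇒⊆T s a b c m = ∈ₜ⇒In a b c (s (a , b , c) (In⇒∈ₜ a b c m))

  nonempty : ∀ {U : TSet n} {t} → t ∈ₜ U → NonemptyT U
  nonempty {t = a , b , c} m = a , b , c , ∈ₜ⇒In a b c m

  ∉ₜ-val : ∀ {U t} → Ascends t → ¬ t ∈ₜ U → val U t ≡ false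
  ∉ₜ-val s ¬m = not-true (λ e → ¬m (member s e))

  _∈ₜ?_ : ∀ t U → Dec (t ∈ₜ U)
  (a , b , c) ∈ₜ? U with true-or-false (lt a b ∧ lt b c) | true-or-false (U a b c)
  ... | inj₁ s | inj₁ v = yes (member s v)
  ... | inj₂ s | _      = no (λ m → true≢false (ascends m) s)
  ... | _      | inj₂ v = no (λ m → true≢false (value m) v)

  ⟪_⟫ : Triple → TSet n
  ⟪ p , q , r ⟫ a b c = eqb a p ∧ (eqb b q ∧ eqb c r)

  ⟪⟫-self : ∀ t → val ⟪ t ⟫ t ≡ true
  ⟪⟫-self (p , q , r) rewrite eqb-refl p | eqb-refl q | eqb-refl r = refl

  ⟪⟫-sound : ∀ s t → val ⟪ t ⟫ s ≡ true → s ≡ t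
  ⟪⟫-sound (a , b , c) (p , q , r) e with a ≟ p | b ≟ q | c ≟ r
  ... | yes refl | yes refl | yes refl = refl

  ⟪⟫-other : ∀ s t → ¬ s ≡ t → val ⟪ t ⟫ s ≡ false
  ⟪⟫-other s t s≢t with val ⟪ t ⟫ s in e
  ... | true  = ⊥-elim (s≢t (⟪⟫-sound s t e))
  ... | false = refl

  _⊹_ : TSet n → Triple → TSet n
  (T ⊹ t) a b c = T a b c ∨ ⟪ t ⟫ a b c

  _∖_ : TSet n → Triple → TSet n
  (T ∖ t) a b c = T a b c ∧ not (⟪ t ⟫ a b c)

  _⊕_ : TSet n → TSet n → TSet n
  (U ⊕ W) a b c = U a b c xor W a b c

  ⊹-old : ∀ {T t} → T ⊆ₜ T ⊹ t
  ⊹-old {T} {t} y (member s v) = member s (cong (_∨ val ⟪ t ⟫ y) v)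

  ⊹-new : ∀ {T} t → Ascends t → t ∈ₜ T ⊹ t
  ⊹-new {T} t s = member s (trans (cong (val T t ∨_) (⟪⟫-self t)) (∨-zeroʳ (val T t)))

  ⊹-elim : ∀ {T t} y → y ∈ₜ T ⊹ t → y ∈ₜ T ⊎ y ≡ t
  ⊹-elim {T} {t} y (member s v) with true-or-false (val T y) | true-or-false (val ⟪ t ⟫ y)
  ... | inj₁ e | _      = inj₁ (member s e)
  ... | inj₂ e | inj₁ e′ = inj₂ (⟪⟫-sound y t e′)
  ... | inj₂ e | inj₂ e′ = ⊥-elim (true≢false v (cong₂ _∨_ e e′))

  ⊹-other : ∀ {A k} y → y ∈ₜ A ⊹ k → ¬ y ≡ k → y ∈ₜ A
  ⊹-other {A} {k} y m y≢k with ⊹-elim {A} {k} y m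
  ... | inj₁ y∈A = y∈A
  ... | inj₂ y≡k = ⊥-elim (y≢k y≡k)

  ⊹-avoid : ∀ {A k R} → R ⊆ₜ A ⊹ k → ¬ k ∈ₜ R → R ⊆ₜ A
  ⊹-avoid {A} {k} R⊆ k∉R y m = ⊹-other {A} {k} y (R⊆ y m) (λ { refl → k∉R m })

  ∖-elim : ∀ {T t} y → y ∈ₜ T ∖ t → y ∈ₜ T × ¬ y ≡ t
  ∖-elim {T} {t} y (member s v) with true-or-false (val T y) | true-or-false (val ⟪ t ⟫ y)
  ... | inj₁ e | inj₂ e′ = member s e , λ { refl → true≢false (⟪⟫-self y) e′ }
  ... | inj₁ e | inj₁ e′ = ⊥-elim (true≢false v (cong₂ (λ u w → u ∧ not w) e e′))
  ... | inj₂ e | _      = ⊥-elim (true≢false v (cong (λ u → u ∧ not (val ⟪ t ⟫ y)) e))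

  ∖-intro : ∀ {T t} y → y ∈ₜ T → ¬ y ≡ t → y ∈ₜ T ∖ t
  ∖-intro {T} {t} y (member s v) y≢t =
    member s (cong₂ (λ u w → u ∧ not w) v (⟪⟫-other y t y≢t))

  ∖-⊆ : ∀ {T t} → T ∖ t ⊆ₜ T
  ∖-⊆ {T} {t} y m = proj₁ (∖-elim {T} {t} y m)

  ⊕-elim : ∀ {U W} y → y ∈ₜ U ⊕ W → (y ∈ₜ U × ¬ y ∈ₜ W) ⊎ (¬ y ∈ₜ U × y ∈ₜ W)
  ⊕-elim {U} {W} y (member s v) with true-or-false (val U y) | true-or-false (val W y)
  ... | inj₁ e | inj₂ e′ = inj₁ (member s e , λ w → true≢false (value w) e′)
  ... | inj₂ e | inj₁ e′ = inj₂ ((λ u → true≢false (value u) e) , member s e′)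
  ... | inj₁ e | inj₁ e′ = ⊥-elim (true≢false v (cong₂ _xor_ e e′))
  ... | inj₂ e | inj₂ e′ = ⊥-elim (true≢false v (cong₂ _xor_ e e′))

  ⊕-introˡ : ∀ {U W} y → y ∈ₜ U → ¬ y ∈ₜ W → y ∈ₜ U ⊕ W
  ⊕-introˡ y (member s v) ¬w = member s (cong₂ _xor_ v (∉ₜ-val s ¬w))

  ⊕-introʳ : ∀ {U W} y → ¬ y ∈ₜ U → y ∈ₜ W → y ∈ₜ U ⊕ W
  ⊕-introʳ y ¬u (member s v) = member s (cong₂ _xor_ (∉ₜ-val s ¬u) v)

  ⊕-both : ∀ {U W} y → y ∈ₜ U → y ∈ₜ W → ¬ y ∈ₜ U ⊕ W
  ⊕-both {U} {W} y u w m with ⊕-elim {U} {W} y m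
  ... | inj₁ (_ , ¬w) = ¬w w
  ... | inj₂ (¬u , _) = ¬u u

  ⊕-neither : ∀ {U W} y → ¬ y ∈ₜ U → ¬ y ∈ₜ W → ¬ y ∈ₜ U ⊕ W
  ⊕-neither {U} {W} y ¬u ¬w m with ⊕-elim {U} {W} y m
  ... | inj₁ (u , _) = ¬u u
  ... | inj₂ (_ , w) = ¬w w

  ⊕-eliminate : ∀ {U W A k} → U ⊆ₜ A ⊹ k → W ⊆ₜ A ⊹ k → k ∈ₜ U → k ∈ₜ W → U ⊕ W ⊆ₜ A
  ⊕-eliminate {U} {W} {A} {k} U⊆ W⊆ kU kW y m with ⊕-elim {U} {W} y m
  ... | inj₁ (u , ¬w) = ⊹-other {A} {k} y (U⊆ y u) (λ { refl → ¬w kW })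
  ... | inj₂ (¬u , w) = ⊹-other {A} {k} y (W⊆ y w) (λ { refl → ¬u kU })

  memT-⊕ : ∀ (U W : TSet n) a b c → memT (U ⊕ W) a b c ≡ memT U a b c xor memT W a b c
  memT-⊕ U W a b c with shape a b c
  ... | coincident κ rewrite memT-coincident (U ⊕ W) κ | memT-coincident U κ | memT-coincident W κ = refl
  ... | arranged s π = trans (memT-arranged (U ⊕ W) s π)
                             (sym (cong₂ _xor_ (memT-arranged U s π) (memT-arranged W s π)))

  cycle-⊕ : ∀ {U W : TSet n} → BoundaryZero U → BoundaryZero W → BoundaryZero (U ⊕ W)
  cycle-⊕ {U} {W} zU zW a b = begin
    edgeParity (U ⊕ W) a b                             ≡⟨ edgeParity-⨁ (U ⊕ W) a b ⟩
    ⨁ n (memT (U ⊕ W) a b)                             ≡⟨ ⨁-cong n (memT-⊕ U W a b) ⟩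
    ⨁ n (λ c → memT U a b c xor memT W a b c)          ≡⟨ ⨁-xor n (memT U a b) (memT W a b) ⟩
    ⨁ n (memT U a b) xor ⨁ n (memT W a b)              ≡⟨ cong₂ _xor_ (boundary zU) (boundary zW) ⟩
    false                                               ∎
    where
    open ≡-Reasoning
    boundary : ∀ {V} → BoundaryZero V → ⨁ n (memT V a b) ≡ false
    boundary {V} zV = trans (sym (edgeParity-⨁ V a b)) (zV a b)

  face : ∀ {a b c} → Sorted a b c → Triple
  face σ = Sorted.lo σ , Sorted.mid σ , Sorted.hi σ

  face-ascends : ∀ {a b c} (σ : Sorted a b c) → Ascends (face σ)
  face-ascends σ rewrite Ascending.p<q (Sorted.ascends σ) | Ascending.q<r (Sorted.ascends σ) = refl

  face-∈ : ∀ {U a b c} (σ : Sorted a b c) → memT U a b c ≡ true → face σ ∈ₜ U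
  face-∈ {U} σ e = member (face-ascends σ) (trans (sym (memT-arranged U (Sorted.ascends σ) (Sorted.arrangement σ))) e)

  face-memT : ∀ {U a b c} (σ : Sorted a b c) → face σ ∈ₜ U → memT U a b c ≡ true
  face-memT {U} σ m = trans (memT-arranged U (Sorted.ascends σ) (Sorted.arrangement σ)) (value m)

module _ {n : ℕ} where

  no-cycle : ∀ {T R : TSet n} {t} → Acyclic T → R ⊆ₜ T → BoundaryZero R → t ∈ₜ R → ⊥
  no-cycle {R = R} acT R⊆T zR m = acT R (⊆ₜ⇒⊆T R⊆T) zR (nonempty m)

  acyclic-⊆ : ∀ {T U : TSet n} → Acyclic T → U ⊆ₜ T → Acyclic U
  acyclic-⊆ acT U⊆T V V⊆U = acT V (⊆ₜ⇒⊆T (λ t m → U⊆T t (⊆T⇒⊆ₜ V⊆U t m)))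

  basis-maximal : ∀ {T T′ : TSet n} → MaxAcyclic T → T ⊆ₜ T′ → Acyclic T′ → T′ ⊆ₜ T
  basis-maximal {T′ = T′} (_ , max) T⊆T′ acT′ = ⊆T⇒⊆ₜ (max T′ (⊆ₜ⇒⊆T T⊆T′) acT′)

  NoCycleThrough : TSet n → Triple → Set
  NoCycleThrough A k = ∀ R → R ⊆ₜ A → BoundaryZero R → k ∈ₜ R → ⊥

  adjoin-acyclic : ∀ {T k} → Acyclic T → NoCycleThrough (T ⊹ k) k → Acyclic (T ⊹ k)
  adjoin-acyclic {T} {k} acT noCycle R R⊆ zR (a , b , c , m) with k ∈ₜ? R
  ... | yes kR = noCycle R (⊆T⇒⊆ₜ R⊆) zR kR
  ... | no ¬kR = no-cycle acT (⊹-avoid {A = T} {k = k} (⊆T⇒⊆ₜ R⊆) ¬kR) zR (In⇒∈ₜ a b c m)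

  fundamental-cycle : ∀ {T k} → MaxAcyclic T → Ascends k → ¬ k ∈ₜ T → NoCycleThrough (T ⊹ k) k → ⊥
  fundamental-cycle {T} {k} mT s ¬kT noCycle =
    ¬kT (basis-maximal mT (⊹-old {T = T} {t = k}) (adjoin-acyclic (proj₁ mT) noCycle) k (⊹-new k s))

  ⊹-mono : ∀ {A B : TSet n} {k} → A ⊆ₜ B → A ⊹ k ⊆ₜ B ⊹ k
  ⊹-mono {A} {B} {k} A⊆B y m with ⊹-elim {T = A} {t = k} y m
  ... | inj₁ y∈A  = ⊹-old {T = B} {t = k} y (A⊆B y y∈A)
  ... | inj₂ refl = ⊹-new {T = B} y (ascends m)

  basis-intro : ∀ {T : TSet n} → Acyclic T →
                (∀ T″ → T ⊆ₜ T″ → Acyclic T″ → ∀ y → y ∈ₜ T″ → ¬ y ∈ₜ T → ⊥) → MaxAcyclic T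
  basis-intro {T} acT no-extra = acT , λ T″ T⊆T″ acT″ → ⊆ₜ⇒⊆T λ y m → decide y m (y ∈ₜ? T) (no-extra T″ (⊆T⇒⊆ₜ T⊆T″) acT″)
    where
    decide : ∀ {T″} y → y ∈ₜ T″ → Dec (y ∈ₜ T) → (∀ y → y ∈ₜ T″ → ¬ y ∈ₜ T → ⊥) → y ∈ₜ T
    decide y _ (yes yT) _     = yT
    decide y m (no ¬yT) extra = ⊥-elim (extra y m ¬yT)

  -- Acyclic half of basis exchange: a cycle through k inside T - t + k would
  -- combine with R into a cycle of T through t.
  exchange-acyclic : ∀ {T R t k} → Acyclic T → t ∈ₜ T → ¬ k ∈ₜ T →
                     R ⊆ₜ T ⊹ k → BoundaryZero R → k ∈ₜ R → t ∈ₜ R → Acyclic (T ∖ t ⊹ k)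
  exchange-acyclic {T} {R} {t} {k} acT tT ¬kT R⊆ zR kR tR =
    adjoin-acyclic (acyclic-⊆ acT (∖-⊆ {T = T} {t = t})) λ R′ R′⊆ zR′ kR′ →
      no-cycle acT
        (⊕-eliminate {U = R′} {W = R} (λ y m → ⊹-mono {A = T ∖ t} {B = T} {k = k} (∖-⊆ {T = T} {t = t}) y (R′⊆ y m)) R⊆ kR′ kR)
        (cycle-⊕ zR′ zR) (⊕-introʳ {U = R′} {W = R} t (λ m → t∉T′ (R′⊆ t m)) tR)
    where
    t∉T′ : ¬ t ∈ₜ T ∖ t ⊹ k
    t∉T′ m = proj₂ (∖-elim {T = T} {t = t} t (⊹-other {A = T ∖ t} {k = k} t m λ { refl → ¬kT tT })) refl

  -- For y = t, R would be a cycle inside T″; otherwise the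
  -- fundamental cycle of y in T, summed with R if it passes through t, would.
  exchange-saturated : ∀ {T R t k} → MaxAcyclic T → R ⊆ₜ T ⊹ k → BoundaryZero R → k ∈ₜ R → t ∈ₜ R →
                       ∀ T″ → T ∖ t ⊹ k ⊆ₜ T″ → Acyclic T″ → ∀ y → y ∈ₜ T″ → ¬ y ∈ₜ T ∖ t ⊹ k → ⊥
  exchange-saturated {T} {R} {t} {k} mT R⊆ zR kR tR T″ T′⊆ acT″ = extra
    where
    T′ = T ∖ t ⊹ k

    k∈T′ : k ∈ₜ T′
    k∈T′ = ⊹-new {T = T ∖ t} k (ascends kR)

    from-T : ∀ z → z ∈ₜ T → ¬ z ≡ t → z ∈ₜ T″
    from-T z zT z≢t = T′⊆ z (⊹-old {T = T ∖ t} {t = k} z (∖-intro z zT z≢t))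

    from-T⊹ : ∀ {X x} → X ⊆ₜ T ⊹ x → x ∈ₜ T″ → ∀ z → z ∈ₜ X → ¬ z ≡ t → z ∈ₜ T″
    from-T⊹ {X} {x} X⊆ xT″ z zX z≢t with ⊹-elim {T = T} {t = x} z (X⊆ z zX)
    ... | inj₁ zT   = from-T z zT z≢t
    ... | inj₂ refl = xT″

    extra : ∀ y → y ∈ₜ T″ → ¬ y ∈ₜ T′ → ⊥
    extra y yT″ ¬yT′ with y ≟ₜ t
    ... | yes refl = no-cycle acT″ R⊆T″ zR kR
      where
      R⊆T″ : R ⊆ₜ T″
      R⊆T″ z zR′ with z ≟ₜ t
      ... | yes refl = yT″
      ... | no z≢t   = from-T⊹ R⊆ (T′⊆ k k∈T′) z zR′ z≢t
    ... | no y≢t = fundamental-cycle mT (ascends yT″) ¬yT λ U U⊆ zU yU → through-y U U⊆ zU yU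
      where
      ¬yT : ¬ y ∈ₜ T
      ¬yT yT = ¬yT′ (⊹-old {T = T ∖ t} {t = k} y (∖-intro y yT y≢t))

      ¬yR : ¬ y ∈ₜ R
      ¬yR yR = ¬yT (⊹-other {A = T} {k = k} y (R⊆ y yR) λ { refl → ¬yT′ k∈T′ })

      through-y : NoCycleThrough (T ⊹ y) y
      through-y U U⊆ zU yU with t ∈ₜ? U
      ... | no ¬tU = no-cycle acT″ (λ z zU′ → from-T⊹ U⊆ yT″ z zU′ λ { refl → ¬tU zU′ }) zU yU
      ... | yes tU = no-cycle acT″ U⊕R⊆T″ (cycle-⊕ zU zR) (⊕-introˡ {U = U} {W = R} y yU ¬yR)
        where
        U⊕R⊆T″ : U ⊕ R ⊆ₜ T″
        U⊕R⊆T″ z m with ⊕-elim {U = U} {W = R} z m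
        ... | inj₁ (zU′ , ¬zR) = from-T⊹ U⊆ yT″ z zU′ λ { refl → ¬zR tR }
        ... | inj₂ (¬zU , zR′) = from-T⊹ R⊆ (T′⊆ k k∈T′) z zR′ λ { refl → ¬zU tU }

  exchange : ∀ {T R t k} → MaxAcyclic T → t ∈ₜ T → ¬ k ∈ₜ T →
             R ⊆ₜ T ⊹ k → BoundaryZero R → k ∈ₜ R → t ∈ₜ R → MaxAcyclic (T ∖ t ⊹ k)
  exchange mT tT ¬kT R⊆ zR kR tR =
    basis-intro (exchange-acyclic (proj₁ mT) tT ¬kT R⊆ zR kR tR) (exchange-saturated mT R⊆ zR kR tR)

  Disjoint : TSet n → TSet n → Set
  Disjoint Y T = ∀ y → y ∈ₜ Y → y ∈ₜ T → ⊥

  In? : ∀ (U : TSet n) a b c → Dec (In U a b c)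
  In? U a b c = _ Bool.≟ true

  meets-or-disjoint : ∀ (Y T : TSet n) → Meets Y T ⊎ Disjoint Y T
  meets-or-disjoint Y T with any? (λ a → any? λ b → any? λ c → In? Y a b c ×-dec In? T a b c)
  ... | yes (a , b , c , yY , yT) = inj₁ (a , b , c , yY , yT)
  ... | no ¬meet = inj₂ λ { (a , b , c) yY yT → ¬meet (a , b , c , ∈ₜ⇒In a b c yY , ∈ₜ⇒In a b c yT) }

  hypercut-minimal : ∀ {C Y : TSet n} → Hypercut C → Y ⊆ₜ C →
                     (∀ T → MaxAcyclic T → Disjoint Y T → ⊥) → C ⊆ₜ Y
  hypercut-minimal {C} {Y} (_ , minimal) Y⊆C meetsAll =
    ⊆T⇒⊆ₜ (minimal Y (⊆ₜ⇒⊆T Y⊆C) λ T mT → meets T mT (meets-or-disjoint Y T))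
    where
    meets : ∀ T → MaxAcyclic T → Meets Y T ⊎ Disjoint Y T → Meets Y T
    meets T mT (inj₁ m)    = m
    meets T mT (inj₂ disj) = ⊥-elim (meetsAll T mT disj)

  -- For t ∈ C there is a basis T with T ∩ C = {t}: otherwise C - t would
  -- already meet every basis.
  Isolating : TSet n → Triple → TSet n → Set
  Isolating C t T = MaxAcyclic T × t ∈ₜ T × (∀ y → y ∈ₜ T → y ∈ₜ C → y ≡ t)

  isolating-basis : ∀ {C t} → Hypercut C → t ∈ₜ C → (∀ T → Isolating C t T → ⊥) → ⊥
  isolating-basis {C} {t} hc tC noBasis =
    proj₂ (∖-elim {T = C} {t = t} t (hypercut-minimal hc (∖-⊆ {T = C} {t = t}) found t tC)) refl
    where
    found : ∀ T → MaxAcyclic T → Disjoint (C ∖ t) T → ⊥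
    found T mT disj with proj₁ hc T mT
    ... | a , b , c , yC , yT = noBasis T (mT , subst (_∈ₜ T) (only _ yT′ yC′) yT′ , only)
      where
      yC′ = In⇒∈ₜ a b c yC
      yT′ = In⇒∈ₜ a b c yT
      only : ∀ y → y ∈ₜ T → y ∈ₜ C → y ≡ t
      only y yT″ yC″ with y ≟ₜ t
      ... | yes y≡t = y≡t
      ... | no y≢t  = ⊥-elim (disj y (∖-intro y yC″ y≢t) yT″)

  allTriples : List Triple
  allTriples = cartesianProduct (allFin n) (cartesianProduct (allFin n) (allFin n))

  ∈-allTriples : ∀ y → y ∈ˡ allTriples
  ∈-allTriples (a , b , c) = ∈-cartesianProduct⁺ (∈-allFin a) (∈-cartesianProduct⁺ (∈-allFin b) (∈-allFin c))

  -- With T a basis meeting C only in t, the cycle K is reduced, one triple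
  -- k ∉ T at a time, by adding fundamental cycles; the triples of K outside T
  -- are tracked by a list L of candidates.  If some fundamental cycle passes
  -- through t, exchanging t for k yields a basis disjoint from C; otherwise the
  -- reduction ends with a nonempty cycle inside T.
  hypercut-not-single : ∀ {C K : TSet n} {t} → Hypercut C → t ∈ₜ C → BoundaryZero K → t ∈ₜ K →
                        (∀ y → y ∈ₜ K → y ∈ₜ C → y ≡ t) → ⊥
  hypercut-not-single {C} {K₀} {t} hc tC zK₀ tK₀ onlyK₀ = isolating-basis hc tC λ T isoT →
    reduce T isoT allTriples K₀ zK₀ tK₀ onlyK₀ (λ y _ _ → ∈-allTriples y)
    where
    drop-candidate : ∀ {K T k L} → (k ∈ₜ K → ¬ k ∈ₜ T → ⊥) →
                     (∀ y → y ∈ₜ K → ¬ y ∈ₜ T → y ∈ˡ k ∷ L) → ∀ y → y ∈ₜ K → ¬ y ∈ₜ T → y ∈ˡ L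
    drop-candidate irrelevant untracked y yK ¬yT with untracked y yK ¬yT
    ... | here refl = ⊥-elim (irrelevant yK ¬yT)
    ... | there y∈L = y∈L

    reduce : ∀ T → Isolating C t T → (L : List Triple) (K : TSet n) → BoundaryZero K → t ∈ₜ K →
             (∀ y → y ∈ₜ K → y ∈ₜ C → y ≡ t) → (∀ y → y ∈ₜ K → ¬ y ∈ₜ T → y ∈ˡ L) → ⊥
    reduce T (mT , tT , onlyT) [] K zK tK onlyK untracked =
      no-cycle (proj₁ mT) K⊆T zK tK
      where
      K⊆T : K ⊆ₜ T
      K⊆T y yK with y ∈ₜ? T
      ... | yes yT = yT
      ... | no ¬yT with untracked y yK ¬yT
      ...   | ()
    reduce T isoT@(mT , tT , onlyT) (k ∷ L) K zK tK onlyK untracked with k ∈ₜ? K | k ∈ₜ? T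
    ... | yes kK | no ¬kT = fundamental-cycle mT (ascends kK) ¬kT add-cycle
      where
      add-cycle : NoCycleThrough (T ⊹ k) k
      add-cycle R R⊆ zR kR with t ∈ₜ? R
      ... | yes tR with proj₁ hc _ (exchange mT tT ¬kT R⊆ zR kR tR)
      ...   | a , b , c , yC , yT′ with ⊹-elim {T = T ∖ t} {t = k} (a , b , c) (In⇒∈ₜ a b c yT′)
      ...     | inj₁ y∈T∖t = proj₂ y∈T-t (onlyT _ (proj₁ y∈T-t) (In⇒∈ₜ a b c yC))
        where y∈T-t = ∖-elim {T = T} {t = t} (a , b , c) y∈T∖t
      ...     | inj₂ refl  = ¬kT (subst (_∈ₜ T) (sym (onlyK k kK (In⇒∈ₜ a b c yC))) tT)
      add-cycle R R⊆ zR kR | no ¬tR =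
        reduce T isoT L (K ⊕ R) (cycle-⊕ zK zR) (⊕-introˡ {U = K} {W = R} t tK ¬tR) onlyK⊕R untracked⊕R
        where
        onlyK⊕R : ∀ y → y ∈ₜ K ⊕ R → y ∈ₜ C → y ≡ t
        onlyK⊕R y m yC with ⊕-elim {U = K} {W = R} y m
        ... | inj₁ (yK , _)   = onlyK y yK yC
        ... | inj₂ (¬yK , yR) = onlyT y (⊹-other {A = T} {k = k} y (R⊆ y yR) λ { refl → ¬yK kK }) yC
        untracked⊕R : ∀ y → y ∈ₜ K ⊕ R → ¬ y ∈ₜ T → y ∈ˡ L
        untracked⊕R y m ¬yT with ⊕-elim {U = K} {W = R} y m
        ... | inj₂ (¬yK , yR) = ⊥-elim (¬yT (⊹-other {A = T} {k = k} y (R⊆ y yR) λ { refl → ¬yK kK }))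
        ... | inj₁ (yK , ¬yR) with untracked y yK ¬yT
        ...   | here refl = ⊥-elim (¬yR kR)
        ...   | there y∈L = y∈L
    ... | yes kK | yes kT = reduce T isoT L K zK tK onlyK (drop-candidate (λ _ ¬kT → ¬kT kT) untracked)
    ... | no ¬kK | _ = reduce T isoT L K zK tK onlyK (drop-candidate (λ kK _ → ¬kK kK) untracked)

  -- For distinct t₀, y ∈ C some cycle through y meets C only inside {t₀, y}:
  -- the fundamental cycle of y with respect to a basis meeting C only in t₀.
  two-point-cycle : ∀ {C : TSet n} {t₀ y} → Hypercut C → t₀ ∈ₜ C → y ∈ₜ C → ¬ y ≡ t₀ →
                    (∀ U → BoundaryZero U → y ∈ₜ U → (∀ z → z ∈ₜ U → z ∈ₜ C → z ≡ t₀ ⊎ z ≡ y) → ⊥) → ⊥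
  two-point-cycle {C} {t₀} {y} hc t₀C yC y≢t₀ noCycle = isolating-basis hc t₀C λ { T (mT , _ , onlyT) →
    fundamental-cycle mT (ascends yC) (λ yT → y≢t₀ (onlyT y yT yC)) λ R R⊆ zR yR →
      noCycle R zR yR λ z zR′ zC → case z (⊹-elim {T = T} {t = y} z (R⊆ z zR′)) zC onlyT }
    where
    case : ∀ {T} z → z ∈ₜ T ⊎ z ≡ y → z ∈ₜ C → (∀ z → z ∈ₜ T → z ∈ₜ C → z ≡ t₀) → z ≡ t₀ ⊎ z ≡ y
    case z (inj₁ zT)  zC onlyT = inj₁ (onlyT z zT zC)
    case z (inj₂ z≡y) zC onlyT = inj₂ z≡y

  Within : TSet n → Triple → Triple → Triple → Triple → Set
  Within Z z₁ z₂ z₃ z₄ = ∀ y → y ∈ₜ Z → y ≡ z₁ ⊎ (y ≡ z₂ ⊎ (y ≡ z₃ ⊎ y ≡ z₄))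

  hypercut-not-triple : ∀ {C Z : TSet n} {z₁ z₂ z₃ z₄} → Hypercut C → BoundaryZero Z → Within Z z₁ z₂ z₃ z₄ →
    z₁ ∈ₜ Z → z₂ ∈ₜ Z → z₃ ∈ₜ Z → z₁ ∈ₜ C → z₂ ∈ₜ C → z₃ ∈ₜ C → ¬ z₄ ∈ₜ C →
    ¬ z₂ ≡ z₁ → ¬ z₃ ≡ z₁ → ¬ z₂ ≡ z₃ → ⊥
  hypercut-not-triple {C} {Z} {z₁} {z₂} {z₃} {z₄} hc zZ within z₁Z z₂Z z₃Z z₁C z₂C z₃C z₄∉C z₂≢z₁ z₃≢z₁ z₂≢z₃ =
    two-point-cycle hc z₁C z₂C z₂≢z₁ λ U₂ zU₂ z₂U₂ onlyU₂ →
    two-point-cycle hc z₁C z₃C z₃≢z₁ λ U₃ zU₃ z₃U₃ onlyU₃ →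
    combine U₂ zU₂ z₂U₂ onlyU₂ U₃ zU₃ z₃U₃ onlyU₃
    where
    avoids : ∀ {U a} → (∀ z → z ∈ₜ U → z ∈ₜ C → z ≡ z₁ ⊎ z ≡ a) →
             ∀ y → y ∈ₜ C → ¬ y ≡ z₁ → ¬ y ≡ a → ¬ y ∈ₜ U
    avoids onlyU y yC y≢z₁ y≢a yU with onlyU y yU yC
    ... | inj₁ e = y≢z₁ e
    ... | inj₂ e = y≢a e

    single : ∀ {U a} → BoundaryZero U → a ∈ₜ U → a ∈ₜ C → ¬ z₁ ∈ₜ U →
             (∀ z → z ∈ₜ U → z ∈ₜ C → z ≡ z₁ ⊎ z ≡ a) → ⊥
    single {U} {a} zU aU aC ¬z₁U onlyU = hypercut-not-single hc aC zU aU λ z zU′ zC → case z zU′ (onlyU z zU′ zC)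
      where
      case : ∀ z → z ∈ₜ U → z ≡ z₁ ⊎ z ≡ a → z ≡ a
      case z zU (inj₁ refl) = ⊥-elim (¬z₁U zU)
      case z zU (inj₂ e)    = e

    -- if z₁ is missing from U₂ or U₃, that cycle meets C only once;
    -- otherwise U₂ + U₃ + Z meets C only in z₁
    combine : ∀ U₂ → BoundaryZero U₂ → z₂ ∈ₜ U₂ → (∀ z → z ∈ₜ U₂ → z ∈ₜ C → z ≡ z₁ ⊎ z ≡ z₂) →
              ∀ U₃ → BoundaryZero U₃ → z₃ ∈ₜ U₃ → (∀ z → z ∈ₜ U₃ → z ∈ₜ C → z ≡ z₁ ⊎ z ≡ z₃) → ⊥
    combine U₂ zU₂ z₂U₂ onlyU₂ U₃ zU₃ z₃U₃ onlyU₃ with z₁ ∈ₜ? U₂ | z₁ ∈ₜ? U₃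
    ... | no ¬z₁U₂ | _         = single zU₂ z₂U₂ z₂C ¬z₁U₂ onlyU₂
    ... | yes _    | no ¬z₁U₃  = single zU₃ z₃U₃ z₃C ¬z₁U₃ onlyU₃
    ... | yes z₁U₂ | yes z₁U₃  =
      hypercut-not-single hc z₁C (cycle-⊕ (cycle-⊕ zU₂ zU₃) zZ)
        (⊕-introʳ {U = U₂ ⊕ U₃} {W = Z} z₁ (⊕-both {U = U₂} {W = U₃} z₁ z₁U₂ z₁U₃) z₁Z) onlyK
      where
      z₂∉U₃ = avoids onlyU₃ z₂ z₂C z₂≢z₁ z₂≢z₃
      z₃∉U₂ = avoids onlyU₂ z₃ z₃C z₃≢z₁ (λ e → z₂≢z₃ (sym e))
      onlyK : ∀ y → y ∈ₜ U₂ ⊕ U₃ ⊕ Z → y ∈ₜ C → y ≡ z₁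
      onlyK y yK yC with y ≟ₜ z₁
      ... | yes e = e
      ... | no y≢z₁ with y ≟ₜ z₂ | y ≟ₜ z₃
      ...   | yes refl | _ = ⊥-elim (⊕-both {U = U₂ ⊕ U₃} {W = Z} y (⊕-introˡ {U = U₂} {W = U₃} y z₂U₂ z₂∉U₃) z₂Z yK)
      ...   | no _ | yes refl = ⊥-elim (⊕-both {U = U₂ ⊕ U₃} {W = Z} y (⊕-introʳ {U = U₂} {W = U₃} y z₃∉U₂ z₃U₃) z₃Z yK)
      ...   | no y≢z₂ | no y≢z₃ =
        ⊥-elim (⊕-neither {U = U₂ ⊕ U₃} {W = Z} y
                  (⊕-neither {U = U₂} {W = U₃} y (avoids onlyU₂ y yC y≢z₁ y≢z₂) (avoids onlyU₃ y yC y≢z₁ y≢z₃))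
                  y∉Z yK)
        where
        y∉Z : ¬ y ∈ₜ Z
        y∉Z yZ with within y yZ
        ... | inj₁ e = y≢z₁ e
        ... | inj₂ (inj₁ e) = y≢z₂ e
        ... | inj₂ (inj₂ (inj₁ e)) = y≢z₃ e
        ... | inj₂ (inj₂ (inj₂ refl)) = z₄∉C yC

  four-cycle-parity : ∀ {C Z : TSet n} {z₁ z₂ z₃ z₄} → Hypercut C → BoundaryZero Z → Within Z z₁ z₂ z₃ z₄ →
    z₁ ∈ₜ Z → z₂ ∈ₜ Z → z₃ ∈ₜ Z → ¬ z₂ ≡ z₁ → ¬ z₃ ≡ z₁ → ¬ z₂ ≡ z₃ →
    z₁ ∈ₜ C → (z₂ ∈ₜ C → z₃ ∈ₜ C) → (z₃ ∈ₜ C → z₂ ∈ₜ C) → z₄ ∈ₜ C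
  four-cycle-parity {C} {Z} {z₁} {z₂} {z₃} {z₄} hc zZ within z₁Z z₂Z z₃Z z₂≢z₁ z₃≢z₁ z₂≢z₃ z₁C z₂⇒z₃ z₃⇒z₂
    with z₄ ∈ₜ? C
  ... | yes z₄C = z₄C
  ... | no z₄∉C with z₂ ∈ₜ? C
  ...   | yes z₂C = ⊥-elim (hypercut-not-triple hc zZ within z₁Z z₂Z z₃Z z₁C z₂C (z₂⇒z₃ z₂C) z₄∉C z₂≢z₁ z₃≢z₁ z₂≢z₃)
  ...   | no z₂∉C = ⊥-elim (hypercut-not-single hc z₁C zZ z₁Z only-z₁)
    where
    only-z₁ : ∀ y → y ∈ₜ Z → y ∈ₜ C → y ≡ z₁
    only-z₁ y yZ yC with within y yZ
    ... | inj₁ e = e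
    ... | inj₂ (inj₁ refl) = ⊥-elim (z₂∉C yC)
    ... | inj₂ (inj₂ (inj₁ refl)) = ⊥-elim (z₂∉C (z₃⇒z₂ yC))
    ... | inj₂ (inj₂ (inj₂ refl)) = ⊥-elim (z₄∉C yC)

module _ {n : ℕ} where

  Σ₃ : (Fin n → Fin n → Fin n → Bool) → Bool
  Σ₃ f = ⨁ n λ a → ⨁ n λ b → ⨁ n λ c → f a b c

  Σ₃-cong : ∀ {f g} → (∀ a b c → f a b c ≡ g a b c) → Σ₃ f ≡ Σ₃ g
  Σ₃-cong e = ⨁-cong n λ a → ⨁-cong n λ b → ⨁-cong n λ c → e a b c

  Σ₃-xor : ∀ f g → Σ₃ (λ a b c → f a b c xor g a b c) ≡ Σ₃ f xor Σ₃ g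
  Σ₃-xor f g = trans (⨁-cong n λ a → trans (⨁-cong n λ b → ⨁-xor n (f a b) (g a b)) (⨁-xor n _ _)) (⨁-xor n _ _)

  Σ₃-swap₂₃ : ∀ f → Σ₃ (λ a b c → f a c b) ≡ Σ₃ f
  Σ₃-swap₂₃ f = ⨁-cong n λ a → ⨁-swap n n (λ b c → f a c b)

  Σ₃-swap₁₂ : ∀ f → Σ₃ (λ a b c → f b a c) ≡ Σ₃ f
  Σ₃-swap₁₂ f = ⨁-swap n n (λ a b → ⨁ n (f b a))

  Σ₃-rotate : ∀ f → Σ₃ (λ a b c → f b c a) ≡ Σ₃ f
  Σ₃-rotate f = trans (Σ₃-swap₁₂ (λ a b c → f a c b)) (Σ₃-swap₂₃ f)

  Σ₃-point : ∀ t → Σ₃ (λ a b c → val ⟪ t ⟫ (a , b , c)) ≡ true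
  Σ₃-point (p , q , r) = begin
    (⨁ n λ a → ⨁ n λ b → ⨁ n λ c → eqb a p ∧ (eqb b q ∧ eqb c r))
      ≡⟨ (⨁-cong n λ a → trans (⨁-cong n λ b → ⨁-scale n (eqb a p) _) (⨁-scale n (eqb a p) _)) ⟩
    (⨁ n λ a → eqb a p ∧ ⨁ n λ b → ⨁ n λ c → eqb b q ∧ eqb c r)
      ≡⟨ ⨁-delta n p _ ⟩
    (⨁ n λ b → ⨁ n λ c → eqb b q ∧ eqb c r)
      ≡⟨ (⨁-cong n λ b → ⨁-scale n (eqb b q) _) ⟩
    (⨁ n λ b → eqb b q ∧ ⨁ n λ c → eqb c r)
      ≡⟨ ⨁-delta n q _ ⟩
    ⨁ n (λ c → eqb c r)
      ≡⟨ ⨁-point n r ⟩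
    true ∎
    where open ≡-Reasoning

  δ : (Fin n → Fin n → Bool) → TSet n
  δ D a b c = D a b xor (D a c xor D b c)

  ⟨_,_⟩ : TSet n → TSet n → Bool
  ⟨ U , V ⟩ = Σ₃ λ a b c → inAsc U a b c ∧ V a b c

  -- A cycle pairs to zero with every coboundary: regrouping by the pair
  -- carrying D turns the pairing into Σ D ab · ∂U(ab).
  cycle⊥coboundary : ∀ {U} (D : Fin n → Fin n → Bool) → BoundaryZero U → ⟨ U , δ D ⟩ ≡ false
  cycle⊥coboundary {U} D zU = begin
    ⟨ U , δ D ⟩
      ≡⟨ Σ₃-cong (λ a b c → distribute (inAsc U a b c) (D a b) (D a c) (D b c)) ⟩
    Σ₃ (λ a b c → on-ab a b c xor (on-ac a c b xor on-bc b c a))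
      ≡⟨ trans (Σ₃-xor _ _) (cong (Σ₃ on-ab xor_) (Σ₃-xor _ _)) ⟩
    Σ₃ on-ab xor (Σ₃ (λ a b c → on-ac a c b) xor Σ₃ (λ a b c → on-bc b c a))
      ≡⟨ cong₂ (λ s s′ → Σ₃ on-ab xor (s xor s′)) (Σ₃-swap₂₃ on-ac) (Σ₃-rotate on-bc) ⟩
    Σ₃ on-ab xor (Σ₃ on-ac xor Σ₃ on-bc)
      ≡⟨ trans (cong (Σ₃ on-ab xor_) (sym (Σ₃-xor _ _))) (sym (Σ₃-xor _ _)) ⟩
    Σ₃ (λ a b c → on-ab a b c xor (on-ac a b c xor on-bc a b c))
      ≡⟨ Σ₃-cong (λ a b c → regroup (D a b) (inAsc U a b c) (inAsc U a c b) (inAsc U c a b)) ⟩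
    Σ₃ (λ a b c → D a b ∧ (inAsc U a b c xor (inAsc U a c b xor inAsc U c a b)))
      ≡⟨ Σ₃-cong (λ a b c → cong (D a b ∧_) (sym (memT-split U a b c))) ⟩
    Σ₃ (λ a b c → D a b ∧ (lt a b ∧ memT U a b c))
      ≡⟨ (⨁-zero n λ a → ⨁-zero n λ b → edge-term a b) ⟩
    false ∎
    where
    open ≡-Reasoning
    on-ab on-ac on-bc : Fin n → Fin n → Fin n → Bool
    on-ab a b c = D a b ∧ inAsc U a b c
    on-ac a b c = D a b ∧ inAsc U a c b
    on-bc a b c = D a b ∧ inAsc U c a b

    distribute : ∀ i x y z → (i ∧ (x xor (y xor z))) ≡ ((x ∧ i) xor ((y ∧ i) xor (z ∧ i)))
    distribute i x y z = begin
      i ∧ (x xor (y xor z))                 ≡⟨ trans (∧-distribˡ-xor i x _) (cong ((i ∧ x) xor_) (∧-distribˡ-xor i y z)) ⟩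
      (i ∧ x) xor ((i ∧ y) xor (i ∧ z))     ≡⟨ cong₂ _xor_ (∧-comm i x) (cong₂ _xor_ (∧-comm i y) (∧-comm i z)) ⟩
      (x ∧ i) xor ((y ∧ i) xor (z ∧ i))     ∎

    regroup : ∀ d x y z → ((d ∧ x) xor ((d ∧ y) xor (d ∧ z))) ≡ (d ∧ (x xor (y xor z)))
    regroup d x y z = sym (trans (∧-distribˡ-xor d x _) (cong ((d ∧ x) xor_) (∧-distribˡ-xor d y z)))

    edge-term : ∀ a b → ⨁ n (λ c → D a b ∧ (lt a b ∧ memT U a b c)) ≡ false
    edge-term a b = begin
      ⨁ n (λ c → D a b ∧ (lt a b ∧ memT U a b c))  ≡⟨ (⨁-cong n λ c → sym (∧-assoc (D a b) (lt a b) _)) ⟩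
      ⨁ n (λ c → (D a b ∧ lt a b) ∧ memT U a b c)  ≡⟨ ⨁-scale n _ (memT U a b) ⟩
      (D a b ∧ lt a b) ∧ ⨁ n (memT U a b)           ≡⟨ cong ((D a b ∧ lt a b) ∧_) (trans (sym (edgeParity-⨁ U a b)) (zU a b)) ⟩
      (D a b ∧ lt a b) ∧ false                       ≡⟨ ∧-zeroʳ _ ⟩
      false ∎

  -- A nonempty coboundary meets every basis: otherwise the fundamental cycle
  -- of one of its triples would pair to one with it.
  coboundary-meets-bases : ∀ D {t T} → t ∈ₜ δ D → MaxAcyclic T → Disjoint (δ D) T → ⊥
  coboundary-meets-bases D {t} {T} tY mT disj =
    fundamental-cycle mT (ascends tY) (λ tT → disj t tY tT) λ R R⊆ zR tR →
      true≢false (trans (Σ₃-cong (only-t R R⊆ tR)) (Σ₃-point t)) (cycle⊥coboundary D zR)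
    where
    only-t : ∀ R → R ⊆ₜ T ⊹ t → t ∈ₜ R → ∀ a b c → (inAsc R a b c ∧ δ D a b c) ≡ val ⟪ t ⟫ (a , b , c)
    only-t R R⊆ tR a b c with true-or-false (inAsc R a b c ∧ δ D a b c)
    ... | inj₁ e with ∧-true {inAsc R a b c} e
    ...   | inR , inY with ⊹-elim {T = T} {t = t} (a , b , c) (R⊆ _ (In⇒∈ₜ {U = R} a b c inR))
    ...     | inj₁ yT   = ⊥-elim (disj _ (member (ascends yT) inY) yT)
    ...     | inj₂ refl = trans e (sym (⟪⟫-self t))
    only-t R R⊆ tR a b c | inj₂ e with true-or-false (val ⟪ t ⟫ (a , b , c))
    ...   | inj₂ e′ = trans e (sym e′)
    ...   | inj₁ e′ with ⟪⟫-sound (a , b , c) t e′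
    ...     | refl = ⊥-elim (true≢false (cong₂ _∧_ (∈ₜ⇒In a b c tR) (value tY)) e)

  δ-symmetric : ∀ {D} → (∀ a b → D a b ≡ D b a) → (∀ a → D a a ≡ false) → Symmetric (δ D)
  δ-symmetric {D} D-sym D-irrefl = record
    { sym₁₂    = λ a b c → cong₂ _xor_ (D-sym a b) (xor-comm (D a c) (D b c))
    ; sym₂₃    = λ a b c → trans (Xor.x∙yz≈y∙xz (D a b) (D a c) (D b c))
                                 (cong (λ e → D a c xor (D a b xor e)) (D-sym b c))
    ; diagonal = λ a c → cong₂ _xor_ (D-irrefl a) (xor-same (D a c))
    }

exclude-two : ∀ i x y → (x ∧ y) ≡ false → (i ∧ (not y ∧ not x)) ≡ i xor ((x ∧ i) xor (y ∧ i))
exclude-two true  true  true  ()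
exclude-two true  true  false _ = refl
exclude-two true  false true  _ = refl
exclude-two true  false false _ = refl
exclude-two false true  true  ()
exclude-two false true  false _ = refl
exclude-two false false true  _ = refl
exclude-two false false false _ = refl

and-xor : ∀ x y → ((x ∧ y) ∧ (x xor y)) ≡ false
and-xor true  true  = refl
and-xor true  false = refl
and-xor false y     = refl

module _ {n : ℕ} where

  distinct : Fin n → Fin n → Fin n → Bool
  distinct p q r = not (eqb p q) ∧ (not (eqb q r) ∧ not (eqb p r))

  distinct-true : ∀ {a b c} → ¬ a ≡ b → ¬ b ≡ c → ¬ a ≡ c → distinct a b c ≡ true
  distinct-true a≢b b≢c a≢c rewrite eqb-distinct a≢b | eqb-distinct b≢c | eqb-distinct a≢c = refl

  _on?_ : ∀ (z : Fin n) (t : Triple) → Dec (z on t)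
  z on? (a , b , c) = (z ≟ a) ⊎-dec ((z ≟ b) ⊎-dec (z ≟ c))

  off : ∀ {z a b c : Fin n} → ¬ z ≡ a → ¬ z ≡ b → ¬ z ≡ c → ¬ z on (a , b , c)
  off z≢a z≢b z≢c (inj₁ e)        = z≢a e
  off z≢a z≢b z≢c (inj₂ (inj₁ e)) = z≢b e
  off z≢a z≢b z≢c (inj₂ (inj₂ e)) = z≢c e

  module Tetrahedron (x u v w : Fin n) where

    inQ : Fin n → Bool
    inQ r = eqb r x xor (eqb r u xor (eqb r v xor eqb r w))

    ∂Q : TSet n
    ∂Q p q r = distinct p q r ∧ (inQ p ∧ (inQ q ∧ inQ r))

    ∂Q-symmetric : Symmetric ∂Q
    ∂Q-symmetric = record { sym₁₂ = swap₁₂′ ; sym₂₃ = swap₂₃′ ; diagonal = diagonal′ }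
      where
      swap₁₂′ : ∀ p q r → ∂Q p q r ≡ ∂Q q p r
      swap₁₂′ p q r = cong₂ _∧_
        (trans (And.x∙yz≈x∙zy (not (eqb p q)) (not (eqb q r)) (not (eqb p r)))
               (cong (λ e → not e ∧ (not (eqb p r) ∧ not (eqb q r))) (eqb-sym p q)))
        (And.x∙yz≈y∙xz (inQ p) (inQ q) (inQ r))
      swap₂₃′ : ∀ p q r → ∂Q p q r ≡ ∂Q p r q
      swap₂₃′ p q r = cong₂ _∧_
        (trans (And.x∙yz≈z∙yx (not (eqb p q)) (not (eqb q r)) (not (eqb p r)))
               (cong (λ e → not (eqb p r) ∧ (not e ∧ not (eqb p q))) (eqb-sym q r)))
        (cong (inQ p ∧_) (∧-comm (inQ q) (inQ r)))
      diagonal′ : ∀ a c → ∂Q a a c ≡ false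
      diagonal′ a c rewrite eqb-refl a = refl

    ∂Q-triangle : ∀ {a b c} → inQ a ≡ true → inQ b ≡ true → inQ c ≡ true →
                  ¬ a ≡ b → ¬ b ≡ c → ¬ a ≡ c → memT ∂Q a b c ≡ true
    ∂Q-triangle {a} {b} {c} ia ib ic a≢b b≢c a≢c =
      trans (memT-symmetric ∂Q-symmetric a b c) (cong₂ _∧_ (distinct-true a≢b b≢c a≢c) (cong₂ _∧_ ia (cong₂ _∧_ ib ic)))

    ⨁-inQ : ⨁ n inQ ≡ false
    ⨁-inQ = begin
      ⨁ n inQ
        ≡⟨ trans (⨁-xor n _ _) (cong (⨁ n (λ r → eqb r x) xor_) (trans (⨁-xor n _ _) (cong (⨁ n (λ r → eqb r u) xor_) (⨁-xor n _ _)))) ⟩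
      ⨁ n (λ r → eqb r x) xor (⨁ n (λ r → eqb r u) xor (⨁ n (λ r → eqb r v) xor ⨁ n (λ r → eqb r w)))
        ≡⟨ cong₂ _xor_ (⨁-point n x) (cong₂ _xor_ (⨁-point n u) (cong₂ _xor_ (⨁-point n v) (⨁-point n w))) ⟩
      false ∎
      where open ≡-Reasoning

    third-points : ∀ {a b} → ¬ a ≡ b → ⨁ n (λ c → inQ c ∧ distinct a b c) ≡ inQ a xor inQ b
    third-points {a} {b} a≢b = begin
      ⨁ n (λ c → inQ c ∧ distinct a b c)
        ≡⟨ (⨁-cong n λ c → trans (cong (λ e → inQ c ∧ (not e ∧ (not (eqb b c) ∧ not (eqb a c)))) (eqb-distinct a≢b))
                                  (exclude-two (inQ c) (eqb a c) (eqb b c) (not-both c))) ⟩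
      ⨁ n (λ c → inQ c xor ((eqb a c ∧ inQ c) xor (eqb b c ∧ inQ c)))
        ≡⟨ trans (⨁-xor n _ _) (cong (⨁ n inQ xor_) (⨁-xor n _ _)) ⟩
      ⨁ n inQ xor (⨁ n (λ c → eqb a c ∧ inQ c) xor ⨁ n (λ c → eqb b c ∧ inQ c))
        ≡⟨ cong₂ _xor_ ⨁-inQ (cong₂ _xor_ (pick a) (pick b)) ⟩
      inQ a xor inQ b ∎
      where
      open ≡-Reasoning
      not-both : ∀ c → (eqb a c ∧ eqb b c) ≡ false
      not-both c with true-or-false (eqb a c) | true-or-false (eqb b c)
      ... | inj₁ e | inj₁ e′ = ⊥-elim (a≢b (trans (eqb-sound e) (sym (eqb-sound e′))))
      ... | inj₁ e | inj₂ e′ = cong₂ _∧_ e e′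
      ... | inj₂ e | _       = cong (_∧ eqb b c) e
      pick : ∀ p → ⨁ n (λ c → eqb p c ∧ inQ c) ≡ inQ p
      pick p = trans (⨁-cong n λ c → cong (_∧ inQ c) (eqb-sym p c)) (⨁-delta n p inQ)

    ∂Q-cycle : BoundaryZero ∂Q
    ∂Q-cycle a b = trans (edgeParity-⨁ ∂Q a b) (trans (⨁-cong n (memT-symmetric ∂Q-symmetric a b)) (sum a b))
      where
      sum : ∀ a b → ⨁ n (∂Q a b) ≡ false
      sum a b = by-cases (a ≟ b)
        where
        by-cases : Dec (a ≡ b) → ⨁ n (∂Q a b) ≡ false
        by-cases (yes refl) = ⨁-zero n (Symmetric.diagonal ∂Q-symmetric a)
        by-cases (no a≢b) = begin
            ⨁ n (∂Q a b)                                       ≡⟨ ⨁-cong n (λ c → regroup (distinct a b c) (inQ a) (inQ b) (inQ c)) ⟩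
            ⨁ n (λ c → (inQ a ∧ inQ b) ∧ (inQ c ∧ distinct a b c)) ≡⟨ ⨁-scale n (inQ a ∧ inQ b) _ ⟩
            (inQ a ∧ inQ b) ∧ ⨁ n (λ c → inQ c ∧ distinct a b c) ≡⟨ cong ((inQ a ∧ inQ b) ∧_) (third-points a≢b) ⟩
            (inQ a ∧ inQ b) ∧ (inQ a xor inQ b)                  ≡⟨ and-xor (inQ a) (inQ b) ⟩
            false ∎
            where
            open ≡-Reasoning
            regroup : ∀ d p q r → (d ∧ (p ∧ (q ∧ r))) ≡ (p ∧ q) ∧ (r ∧ d)
            regroup d p q r = trans (∧-comm d _) (trans (cong (_∧ d) (sym (∧-assoc p q r))) (∧-assoc (p ∧ q) r d))

  ≢-flip : ∀ {a b : Fin n} → ¬ a ≡ b → ¬ b ≡ a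
  ≢-flip a≢b e = a≢b (sym e)

  on-face : ∀ {a b c z : Fin n} (σ : Sorted a b c) → z on (a , b , c) → z on face σ
  on-face σ = arranged-on (Sorted.arrangement σ)

  face-on : ∀ {a b c z : Fin n} (σ : Sorted a b c) → z on face σ → z on (a , b , c)
  face-on σ = arranged-on (arrangement⁻¹ (Sorted.arrangement σ))

  faces-differ : ∀ {a b c a′ b′ c′ z : Fin n} (σ : Sorted a b c) (σ′ : Sorted a′ b′ c′) →
                 z on (a , b , c) → ¬ z on (a′ , b′ , c′) → ¬ face σ′ ≡ face σ
  faces-differ σ σ′ z-on z-off e = z-off (face-on σ′ (subst (_ on_) (sym e) (on-face σ z-on)))

  module Faces {x u v w : Fin n} (x≢u : ¬ x ≡ u) (x≢v : ¬ x ≡ v) (x≢w : ¬ x ≡ w)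
               (u≢v : ¬ u ≡ v) (u≢w : ¬ u ≡ w) (v≢w : ¬ v ≡ w) where
    open Tetrahedron x u v w public
    σ₁ = sort x u v x≢u u≢v x≢v
    σ₂ = sort x u w x≢u u≢w x≢w
    σ₃ = sort x v w x≢v v≢w x≢w
    σ₄ = sort u v w u≢v v≢w u≢w

    inQ-x : inQ x ≡ true
    inQ-x rewrite eqb-refl x | eqb-distinct x≢u | eqb-distinct x≢v | eqb-distinct x≢w = refl
    inQ-u : inQ u ≡ true
    inQ-u rewrite eqb-distinct (≢-flip x≢u) | eqb-refl u | eqb-distinct u≢v | eqb-distinct u≢w = refl
    inQ-v : inQ v ≡ true
    inQ-v rewrite eqb-distinct (≢-flip x≢v) | eqb-distinct (≢-flip u≢v) | eqb-refl v | eqb-distinct v≢w = refl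
    inQ-w : inQ w ≡ true
    inQ-w rewrite eqb-distinct (≢-flip x≢w) | eqb-distinct (≢-flip u≢w) | eqb-distinct (≢-flip v≢w) | eqb-refl w = refl

    in-Q : ∀ z → inQ z ≡ true → z ≡ x ⊎ (z ≡ u ⊎ (z ≡ v ⊎ z ≡ w))
    in-Q z e with z ≟ x | z ≟ u | z ≟ v | z ≟ w
    ... | yes p | _     | _     | _     = inj₁ p
    ... | no _  | yes p | _     | _     = inj₂ (inj₁ p)
    ... | no _  | no _  | yes p | _     = inj₂ (inj₂ (inj₁ p))
    ... | no _  | no _  | no _  | yes p = inj₂ (inj₂ (inj₂ p))
    ... | no _  | no _  | no _  | no _  = ⊥-elim (true≢false e refl)

    -- ∂Q is supported on the four faces: an ascending triple of points of Q
    -- omits some point of Q, so it is the face of the other three.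
    support : Within ∂Q (face σ₁) (face σ₂) (face σ₃) (face σ₄)
    support y@(p , q , r) m = classify (w on? y) (v on? y) (u on? y)
      where
      s = ascending p q r (proj₁ (∧-true {lt p q} (ascends m))) (proj₂ (∧-true {lt p q} (ascends m)))
      inQ-pqr = proj₂ (∧-true {distinct p q r} (value m))
      inQ-p = proj₁ (∧-true {inQ p} inQ-pqr)
      inQ-q = proj₁ (∧-true {inQ q} (proj₂ (∧-true {inQ p} inQ-pqr)))
      inQ-r = proj₂ (∧-true {inQ q} (proj₂ (∧-true {inQ p} inQ-pqr)))

      points-in-Q : ∀ z → z on y → z ≡ x ⊎ (z ≡ u ⊎ (z ≡ v ⊎ z ≡ w))
      points-in-Q z (inj₁ refl)        = in-Q z inQ-p
      points-in-Q z (inj₂ (inj₁ refl)) = in-Q z inQ-q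
      points-in-Q z (inj₂ (inj₂ refl)) = in-Q z inQ-r

      is-face : ∀ {a b c} (σ : Sorted a b c) → (∀ z → z on y → z on (a , b , c)) → y ≡ face σ
      is-face σ within = ascending-on s (Sorted.ascends σ)
        (on-face σ (within p (inj₁ refl))) (on-face σ (within q (inj₂ (inj₁ refl)))) (on-face σ (within r (inj₂ (inj₂ refl))))

      classify : Dec (w on y) → Dec (v on y) → Dec (u on y) → y ≡ face σ₁ ⊎ (y ≡ face σ₂ ⊎ (y ≡ face σ₃ ⊎ y ≡ face σ₄))
      classify (no w∉y) _ _ = inj₁ (is-face σ₁ λ z z∈y → omit z z∈y (points-in-Q z z∈y))
        where
        omit : ∀ z → z on y → z ≡ x ⊎ (z ≡ u ⊎ (z ≡ v ⊎ z ≡ w)) → z on (x , u , v)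
        omit z _ (inj₁ e)                = inj₁ e
        omit z _ (inj₂ (inj₁ e))         = inj₂ (inj₁ e)
        omit z _ (inj₂ (inj₂ (inj₁ e)))  = inj₂ (inj₂ e)
        omit z z∈y (inj₂ (inj₂ (inj₂ refl))) = ⊥-elim (w∉y z∈y)
      classify (yes _) (no v∉y) _ = inj₂ (inj₁ (is-face σ₂ λ z z∈y → omit z z∈y (points-in-Q z z∈y)))
        where
        omit : ∀ z → z on y → z ≡ x ⊎ (z ≡ u ⊎ (z ≡ v ⊎ z ≡ w)) → z on (x , u , w)
        omit z _ (inj₁ e)                = inj₁ e
        omit z _ (inj₂ (inj₁ e))         = inj₂ (inj₁ e)
        omit z z∈y (inj₂ (inj₂ (inj₁ refl))) = ⊥-elim (v∉y z∈y)
        omit z _ (inj₂ (inj₂ (inj₂ e)))  = inj₂ (inj₂ e)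
      classify (yes _) (yes _) (no u∉y) = inj₂ (inj₂ (inj₁ (is-face σ₃ λ z z∈y → omit z z∈y (points-in-Q z z∈y))))
        where
        omit : ∀ z → z on y → z ≡ x ⊎ (z ≡ u ⊎ (z ≡ v ⊎ z ≡ w)) → z on (x , v , w)
        omit z _ (inj₁ e)                = inj₁ e
        omit z z∈y (inj₂ (inj₁ refl))    = ⊥-elim (u∉y z∈y)
        omit z _ (inj₂ (inj₂ (inj₁ e)))  = inj₂ (inj₁ e)
        omit z _ (inj₂ (inj₂ (inj₂ e)))  = inj₂ (inj₂ e)
      classify (yes w∈y) (yes v∈y) (yes u∈y) =
        inj₂ (inj₂ (inj₂ (sym (ascending-on (Sorted.ascends σ₄) s (on-y (inj₁ refl)) (on-y (inj₂ (inj₁ refl))) (on-y (inj₂ (inj₂ refl)))))))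
        where
        from-uvw : ∀ {z} → z on (u , v , w) → z on y
        from-uvw (inj₁ refl)        = u∈y
        from-uvw (inj₂ (inj₁ refl)) = v∈y
        from-uvw (inj₂ (inj₂ refl)) = w∈y
        on-y : ∀ {z} → z on face σ₄ → z on y
        on-y z∈ = from-uvw (face-on σ₄ z∈)

    face₁∈∂Q : face σ₁ ∈ₜ ∂Q
    face₁∈∂Q = face-∈ σ₁ (∂Q-triangle inQ-x inQ-u inQ-v x≢u u≢v x≢v)
    face₂∈∂Q : face σ₂ ∈ₜ ∂Q
    face₂∈∂Q = face-∈ σ₂ (∂Q-triangle inQ-x inQ-u inQ-w x≢u u≢w x≢w)
    face₃∈∂Q : face σ₃ ∈ₜ ∂Q
    face₃∈∂Q = face-∈ σ₃ (∂Q-triangle inQ-x inQ-v inQ-w x≢v v≢w x≢w)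

    face₂≢face₁ : ¬ face σ₂ ≡ face σ₁
    face₂≢face₁ = faces-differ σ₁ σ₂ (inj₂ (inj₂ refl)) (off (≢-flip x≢v) (≢-flip u≢v) v≢w)
    face₃≢face₁ : ¬ face σ₃ ≡ face σ₁
    face₃≢face₁ = faces-differ σ₁ σ₃ (inj₂ (inj₁ refl)) (off (≢-flip x≢u) u≢v u≢w)
    face₂≢face₃ : ¬ face σ₂ ≡ face σ₃
    face₂≢face₃ = faces-differ σ₃ σ₂ (inj₂ (inj₁ refl)) (off (≢-flip x≢v) (≢-flip u≢v) v≢w)

  -- The main local lemma: for distinct x, u, v, w, if C ∋ xuv and C contains
  -- xuw exactly when it contains xvw, then C ∋ uvw, because the four faces
  -- of the tetrahedron form a cycle, which a hypercut meets evenly.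
  tetrahedron-parity : ∀ {C : TSet n} {x u v w} → Hypercut C →
    ¬ x ≡ u → ¬ x ≡ v → ¬ x ≡ w → ¬ u ≡ v → ¬ u ≡ w → ¬ v ≡ w →
    memT C x u v ≡ true → memT C x u w ≡ memT C x v w → memT C u v w ≡ true
  tetrahedron-parity {C} {x} {u} {v} {w} hc x≢u x≢v x≢w u≢v u≢w v≢w xuv∈C xuw≡xvw =
    face-memT σ₄ (four-cycle-parity hc ∂Q-cycle support face₁∈∂Q face₂∈∂Q face₃∈∂Q
                                    face₂≢face₁ face₃≢face₁ face₂≢face₃
                                    (face-∈ σ₁ xuv∈C)
                                    (λ m → face-∈ σ₃ (trans (sym xuw≡xvw) (face-memT σ₂ m)))
                                    (λ m → face-∈ σ₂ (trans xuw≡xvw (face-memT σ₃ m))))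
    where open Faces x≢u x≢v x≢w u≢v u≢w v≢w

record Colouring {n} (A : Subset n) (m : ℕ) : Set where
  field
    colour : Fin n → Maybe (Fin m)
    in-A   : ∀ v i → colour v ≡ just i → v ∈ A
    onto   : ∀ i → Σ (Fin n) λ v → colour v ≡ just i
open Colouring

colouring : ∀ {n} (A : Subset n) m → m ≤ ∣ A ∣ → Colouring A m
colouring [] zero _ = record { colour = λ () ; in-A = λ () ; onto = λ () }
colouring (inside ∷ A) zero _ = record { colour = λ _ → nothing ; in-A = λ _ _ () ; onto = λ () }
colouring (inside ∷ A) (suc m) (s≤s m≤∣A∣) = record { colour = colour′ ; in-A = in-A′ ; onto = onto′ }
  where
  κ = colouring A m m≤∣A∣
  colour′ : Fin _ → Maybe (Fin (suc m))
  colour′ zero    = just zero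
  colour′ (suc v) = colour κ v >>= λ i → just (suc i)
  in-A′ : ∀ v i → colour′ v ≡ just i → v ∈ (inside ∷ A)
  in-A′ zero    i e = here
  in-A′ (suc v) i e with colour κ v in eq
  ... | just j = there (in-A κ v j eq)
  onto′ : ∀ i → Σ (Fin _) λ v → colour′ v ≡ just i
  onto′ zero = zero , refl
  onto′ (suc i) with onto κ i
  ... | v , e = suc v , cong (_>>= λ j → just (suc j)) e
colouring (outside ∷ A) m m≤∣A∣ = record { colour = colour′ ; in-A = in-A′ ; onto = onto′ }
  where
  κ = colouring A m m≤∣A∣
  colour′ : Fin _ → Maybe (Fin m)
  colour′ zero    = nothing
  colour′ (suc v) = colour κ v
  in-A′ : ∀ v i → colour′ v ≡ just i → v ∈ (outside ∷ A)
  in-A′ (suc v) i e = there (in-A κ v i e)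
  onto′ : ∀ i → Σ (Fin _) λ v → colour′ v ≡ just i
  onto′ i = suc (proj₁ (onto κ i)) , proj₂ (onto κ i)

Onto : ∀ {a b} → (Fin a → Maybe (Fin b)) → Set
Onto {a} {b} ρ = ∀ j → Σ (Fin a) λ i → ρ i ≡ just j

recolour : ∀ {n} {A : Subset n} {k l} (κ : Colouring A k) (ρ : Fin k → Maybe (Fin l)) → Onto ρ → Colouring A l
recolour {n} {A} κ ρ ρ-onto = record { colour = λ v → colour κ v >>= ρ ; in-A = in-A′ ; onto = onto′ }
  where
  in-A′ : ∀ v i → (colour κ v >>= ρ) ≡ just i → v ∈ A
  in-A′ v i e with colour κ v in eq
  ... | just j = in-A κ v j eq
  onto′ : ∀ i → Σ (Fin n) λ v → (colour κ v >>= ρ) ≡ just i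
  onto′ i with ρ-onto i
  ... | j , ρj with onto κ j
  ...   | v , e = v , trans (cong (_>>= ρ) e) ρj

delete : ∀ {k} → Fin (suc k) → Fin (suc k) → Maybe (Fin k)
delete d i with d ≟ i
... | yes _  = nothing
... | no d≢i = just (punchOut d≢i)

delete-onto : ∀ {k} (d : Fin (suc k)) → Onto (delete d)
delete-onto d j = punchIn d j , lemma
  where
  lemma : delete d (punchIn d j) ≡ just j
  lemma with d ≟ punchIn d j
  ... | yes e = ⊥-elim (punchInᵢ≢i d j (sym e))
  ... | no _  = cong just (trans (punchOut-cong d refl) (punchOut-punchIn d))

delete-self : ∀ {k} (d : Fin (suc k)) → delete d d ≡ nothing
delete-self d with d ≟ d
... | yes _  = refl
... | no d≢d = ⊥-elim (d≢d refl)

merge : ∀ {k} (i j : Fin (suc k)) → ¬ i ≡ j → Fin (suc k) → Maybe (Fin k)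
merge i j i≢j l with i ≟ l
... | yes _  = just (punchOut i≢j)
... | no i≢l = just (punchOut i≢l)

merge-onto : ∀ {k} (i j : Fin (suc k)) (i≢j : ¬ i ≡ j) → Onto (merge i j i≢j)
merge-onto i j i≢j l = punchIn i l , lemma
  where
  lemma : merge i j i≢j (punchIn i l) ≡ just l
  lemma with i ≟ punchIn i l
  ... | yes e = ⊥-elim (punchInᵢ≢i i l (sym e))
  ... | no _  = cong just (trans (punchOut-cong i refl) (punchOut-punchIn i))

merge-identifies : ∀ {k} (i j : Fin (suc k)) (i≢j : ¬ i ≡ j) → merge i j i≢j i ≡ merge i j i≢j j
merge-identifies i j i≢j with i ≟ i | i ≟ j
... | no i≢i | _     = ⊥-elim (i≢i refl)
... | yes _  | yes e = ⊥-elim (i≢j e)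
... | yes _  | no _  = cong just (punchOut-cong i refl)

identify : ∀ {k} (c c′ : Maybe (Fin (suc k))) →
           Σ (Fin (suc k) → Maybe (Fin k)) λ ρ → Onto ρ × (c >>= ρ) ≡ (c′ >>= ρ)
identify nothing  nothing  = delete zero , delete-onto zero , refl
identify (just i) nothing  = delete i , delete-onto i , delete-self i
identify nothing  (just j) = delete j , delete-onto j , sym (delete-self j)
identify (just i) (just j) with i ≟ j
... | yes refl = delete zero , delete-onto zero , refl
... | no i≢j   = merge i j i≢j , merge-onto i j i≢j , merge-identifies i j i≢j

module Counting {n : ℕ} (A : Subset n) where

  Edge = Fin n × Fin n

  Respects : ∀ {m} → Colouring A m → List Edge → Set
  Respects κ L = All (λ e → colour κ (proj₁ e) ≡ colour κ (proj₂ e)) L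

  MeetsA : Edge → Set
  MeetsA (a , b) = a ∈ A ⊎ b ∈ A

  meetsA? : Decidable MeetsA
  meetsA? (a , b) = (a ∈? A) ⊎-dec (b ∈? A)

  private
    ∸-suc : ∀ m c → m ∸ c ≤ suc (m ∸ suc c)
    ∸-suc zero    zero    = z≤n
    ∸-suc zero    (suc c) = z≤n
    ∸-suc (suc m) zero    = s≤s ≤-refl
    ∸-suc (suc m) (suc c) = ∸-suc m c

  -- Each edge meeting A joins at most two colour classes, so fewer than
  -- |A| - c such edges leave at least c + 1 monochromatic classes.
  few-edges⇒colouring : ∀ (L : List Edge) c →
    length (filter meetsA? L) ≥ ∣ A ∣ ∸ c ⊎ Σ (Colouring A (suc c)) λ κ → Respects κ L
  few-edges⇒colouring [] c with ∣ A ∣ ≤? c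
  ... | yes ∣A∣≤c = inj₁ (subst (_≤ 0) (sym (m≤n⇒m∸n≡0 ∣A∣≤c)) z≤n)
  ... | no ∣A∣≰c  = inj₂ (colouring A (suc c) (≰⇒> ∣A∣≰c) , [])
  few-edges⇒colouring ((u , v) ∷ L) c with meetsA? (u , v)
  ... | yes meets with few-edges⇒colouring L (suc c)
  ...   | inj₁ many = inj₁ (subst (λ l → ∣ A ∣ ∸ c ≤ length l) (sym (filter-accept meetsA? meets))
                                   (≤-trans (∸-suc ∣ A ∣ c) (s≤s many)))
  ...   | inj₂ (κ , resp) with identify (colour κ u) (colour κ v)
  ...     | ρ , ρ-onto , agree = inj₂ (recolour κ ρ ρ-onto , agree ∷ All.map (cong (_>>= ρ)) resp)
  few-edges⇒colouring ((u , v) ∷ L) c | no misses with few-edges⇒colouring L c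
  ... | inj₁ many = inj₁ (subst (λ l → ∣ A ∣ ∸ c ≤ length l) (sym (filter-reject meetsA? misses)) many)
  ... | inj₂ (κ , resp) = inj₂ (κ , trans (uncoloured u (misses ∘ inj₁)) (sym (uncoloured v (misses ∘ inj₂))) ∷ resp)
    where
    uncoloured : ∀ w → ¬ w ∈ A → colour κ w ≡ nothing
    uncoloured w w∉A with colour κ w in e
    ... | just i  = ⊥-elim (w∉A (in-A κ w i e))
    ... | nothing = refl

-- The setting of claim1.
module Main {n : ℕ} (C : TSet n) (hc : Hypercut C) (x : Fin n) (S A : Subset n)
            (x∉A : x ∉ A) (A∩S=∅ : ∀ u → u ∈ A → u ∉ S) (atom : IsAtom C x S A) where

  open Counting A

  G′ : Edge → Set
  G′ (a , b) = a <F b × CoLinkAdj C x a b × a ∉ S × b ∉ S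

  G′? : Decidable G′
  G′? (a , b) = a <F? b ×-dec (¬? (a ≟ x) ×-dec ¬? (b ≟ x) ×-dec ¬? (a ≟ b) ×-dec memT C x a b Bool.≟ false)
                        ×-dec ¬? (a ∈? S) ×-dec ¬? (b ∈? S)

  edges : List Edge
  edges = filter G′? (cartesianProduct (allFin n) (allFin n))

  meeting : List Edge
  meeting = filter meetsA? edges

  meeting-unique : Unique meeting
  meeting-unique = unique-filter⁺ meetsA? (unique-filter⁺ G′? (cartesianProduct⁺ (allFin⁺ n) (allFin⁺ n)))

  meeting-all : All (EdgeG'MeetingA C x S A) meeting
  meeting-all = All.map (λ { ((a<b , adj , a∉S , b∉S) , meets) → a<b , adj , a∉S , b∉S , meets })
    (All.zip (all-filter⁺ meetsA? (all-filter G′? (cartesianProduct (allFin n) (allFin n))) , all-filter meetsA? edges))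

  module ThreeColours (κ : Colouring A 3) (resp : Respects κ edges) where

    0F 1F 2F : Fin 3
    0F = zero
    1F = suc zero
    2F = suc (suc zero)

    coloured≢x : ∀ {v i} → colour κ v ≡ just i → ¬ v ≡ x
    coloured≢x {v} {i} e refl = x∉A (in-A κ v i e)

    coloured∉S : ∀ {v i} → colour κ v ≡ just i → v ∉ S
    coloured∉S {v} {i} e = A∩S=∅ v (in-A κ v i e)

    other-colour : ∀ {v w i j} → colour κ v ≡ just i → colour κ w ≡ just j → ¬ i ≡ j → ¬ v ≡ w
    other-colour ev ew i≢j refl = i≢j (just-injective (trans (sym ev) ew))

    monochromatic : ∀ {a b} → G′ (a , b) → colour κ a ≡ colour κ b
    monochromatic {a} {b} g = All.lookup resp (∈-filter⁺ G′? (∈-cartesianProduct⁺ (∈-allFin a) (∈-allFin b)) g)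

    -- A vertex of colour κ i spans a triangle with x and every vertex w ∉ S,
    -- w ≠ x, not of colour κ i: otherwise vw would be an edge of G′.
    linked : ∀ {v w i} → colour κ v ≡ just i → ¬ w ≡ x → w ∉ S → ¬ w ≡ v → ¬ colour κ w ≡ just i →
             memT C x v w ≡ true
    linked {v} {w} ev w≢x w∉S w≢v w≢i with true-or-false (memT C x v w)
    ... | inj₁ xvw∈C = xvw∈C
    ... | inj₂ xvw∉C with compare v w
    ...   | less v<w _ = ⊥-elim (w≢i (trans (sym (monochromatic
                           (lt-sound v w v<w , (coloured≢x ev , w≢x , ≢-flip w≢v , xvw∉C) , coloured∉S ev , w∉S))) ev))
    ...   | greater _ w<v = ⊥-elim (w≢i (trans (monochromatic
                           (lt-sound w v w<v , (w≢x , coloured≢x ev , w≢v , trans (memT-swap₂₃ C x w v) xvw∉C) , w∉S , coloured∉S ev)) ev))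
    ...   | equal v≡w = ⊥-elim (w≢v (sym v≡w))

    -- Vertices of colours 0 and 1 span a triangle of C with every vertex w
    -- of neither colour: for w = x by `linked`, otherwise by the tetrahedron
    -- lemma, the atom property of A handling w ∈ S.
    across : ∀ {u v w} → colour κ u ≡ just 0F → colour κ v ≡ just 1F →
             ¬ colour κ w ≡ just 0F → ¬ colour κ w ≡ just 1F → memT C u v w ≡ true
    across {u} {v} {w} eu ev w≢0 w≢1 with w ≟ x
    ... | yes refl = trans (memT-swap₂₃ C u v x) (trans (memT-swap₁₂ C u x v) xuv∈C)
      where
      xuv∈C = linked eu (coloured≢x ev) (coloured∉S ev) (other-colour ev eu (λ ())) (λ e → 1≢0 (trans (sym ev) e))
        where 1≢0 : ¬ just 1F ≡ just 0F
              1≢0 ()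
    ... | no w≢x = tetrahedron-parity hc (≢-flip u≢x) (≢-flip v≢x) (≢-flip w≢x) u≢v u≢w v≢w
                     (linked eu v≢x (coloured∉S ev) (≢-flip u≢v) v≢0) xuw≡xvw
      where
      u≢x = coloured≢x eu
      v≢x = coloured≢x ev
      u≢v = other-colour eu ev (λ ())
      u≢w : ¬ u ≡ w
      u≢w refl = w≢0 eu
      v≢w : ¬ v ≡ w
      v≢w refl = w≢1 ev
      v≢0 : ¬ colour κ v ≡ just 0F
      v≢0 e with trans (sym ev) e
      ... | ()
      xuw≡xvw : memT C x u w ≡ memT C x v w
      xuw≡xvw with w ∈? S
      ... | no w∉S = trans (linked eu w≢x w∉S (≢-flip u≢w) w≢0) (sym (linked ev w≢x w∉S (≢-flip v≢w) w≢1))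
      ... | yes w∈S with true-or-false (memT C x u w) | true-or-false (memT C x v w)
      ...   | inj₁ e | inj₁ e′ = trans e (sym e′)
      ...   | inj₂ e | inj₂ e′ = trans e (sym e′)
      ...   | inj₂ e | inj₁ e′ =
        ⊥-elim (true≢false e′ (proj₂ (proj₂ (proj₂ (proj₁ (atom u v w (in-A κ u 0F eu) (in-A κ v 1F ev) w∈S) (u≢x , w≢x , u≢w , e))))))
      ...   | inj₁ e | inj₂ e′ =
        ⊥-elim (true≢false e (proj₂ (proj₂ (proj₂ (proj₂ (atom u v w (in-A κ u 0F eu) (in-A κ v 1F ev) w∈S) (v≢x , w≢x , v≢w , e′))))))

    painted : Maybe (Fin 3) → Fin 3 → Bool
    painted nothing  _ = false
    painted (just i) k = eqb i k

    D : Fin n → Fin n → Bool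
    D a b = (painted (colour κ a) 0F ∧ painted (colour κ b) 1F) xor (painted (colour κ a) 1F ∧ painted (colour κ b) 0F)

    D-sym : ∀ a b → D a b ≡ D b a
    D-sym a b = trans (cong₂ _xor_ (∧-comm (painted (colour κ a) 0F) _) (∧-comm (painted (colour κ a) 1F) _))
                (xor-comm (painted (colour κ b) 1F ∧ painted (colour κ a) 0F) (painted (colour κ b) 0F ∧ painted (colour κ a) 1F))

    D-irrefl : ∀ a → D a a ≡ false
    D-irrefl a = trans (cong ((painted (colour κ a) 0F ∧ painted (colour κ a) 1F) xor_) (∧-comm (painted (colour κ a) 1F) _))
                       (xor-same (painted (colour κ a) 0F ∧ painted (colour κ a) 1F))

    zero-one : ∀ c c′ → ((painted c 0F ∧ painted c′ 1F) xor (painted c 1F ∧ painted c′ 0F)) ≡ true →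
               (c ≡ just 0F × c′ ≡ just 1F) ⊎ (c ≡ just 1F × c′ ≡ just 0F)
    zero-one nothing                 c′                     ()
    zero-one (just zero)             nothing                ()
    zero-one (just zero)             (just zero)            ()
    zero-one (just zero)             (just (suc zero))      _ = inj₁ (refl , refl)
    zero-one (just zero)             (just (suc (suc zero))) ()
    zero-one (just (suc zero))       nothing                ()
    zero-one (just (suc zero))       (just zero)            _ = inj₂ (refl , refl)
    zero-one (just (suc zero))       (just (suc zero))      ()
    zero-one (just (suc zero))       (just (suc (suc zero))) ()
    zero-one (just (suc (suc zero))) c′                     ()

    D-01 : ∀ {a b} → colour κ a ≡ just 0F → colour κ b ≡ just 1F → D a b ≡ true
    D-01 ea eb rewrite ea | eb = refl

    D-10 : ∀ {a b} → colour κ a ≡ just 1F → colour κ b ≡ just 0F → D a b ≡ true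
    D-10 ea eb rewrite ea | eb = refl

    D-same : ∀ {a b} → colour κ a ≡ colour κ b → D a b ≡ false
    D-same {a} {b} e = trans (cong (λ c → (painted (colour κ a) 0F ∧ painted c 1F) xor (painted (colour κ a) 1F ∧ painted c 0F)) (sym e))
                             (D-irrefl a)

    D-x : ∀ b → D x b ≡ false
    D-x b with colour κ x in e
    ... | nothing = refl
    ... | just i  = ⊥-elim (x∉A (in-A κ x i e))

    odd-triple : ∀ a b c → D a b ≡ true → D a c ≡ false → D b c ≡ false → memT C a b c ≡ true
    odd-triple a b c dab dac dbc with zero-one (colour κ a) (colour κ b) dab
    ... | inj₁ (a0 , b1) = across a0 b1 (λ c0 → true≢false (D-10 b1 c0) dbc) (λ c1 → true≢false (D-01 a0 c1) dac)
    ... | inj₂ (a1 , b0) = trans (memT-swap₁₂ C a b c)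
                                 (across b0 a1 (λ c0 → true≢false (D-10 a1 c0) dac) (λ c1 → true≢false (D-01 b0 c1) dbc))

    not-three : ∀ p q r → D p q ≡ true → D p r ≡ true → D q r ≡ false
    not-three p q r dpq dpr with zero-one (colour κ p) (colour κ q) dpq | zero-one (colour κ p) (colour κ r) dpr
    ... | inj₁ (_ , q1) | inj₁ (_ , r1) = D-same (trans q1 (sym r1))
    ... | inj₂ (_ , q0) | inj₂ (_ , r0) = D-same (trans q0 (sym r0))
    ... | inj₁ (p0 , _) | inj₂ (p1 , _) with trans (sym p0) p1
    ...   | ()
    not-three p q r dpq dpr | inj₂ (p1 , _) | inj₁ (p0 , _) with trans (sym p0) p1
    ...   | ()

    δD⊆C : δ D ⊆ₜ C
    δD⊆C (p , q , r) m = member (ascends m) (trans (sym (memT-arranged C s pqr)) (in-C (value m)))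
      where
      s = ascending p q r (proj₁ (∧-true {lt p q} (ascends m))) (proj₂ (∧-true {lt p q} (ascends m)))
      in-C : δ D p q r ≡ true → memT C p q r ≡ true
      in-C odd with true-or-false (D p q) | true-or-false (D p r) | true-or-false (D q r)
      ... | inj₁ d₁ | inj₂ d₂ | inj₂ d₃ = odd-triple p q r d₁ d₂ d₃
      ... | inj₂ d₁ | inj₁ d₂ | inj₂ d₃ = trans (memT-swap₂₃ C p q r) (odd-triple p r q d₂ d₁ (trans (D-sym r q) d₃))
      ... | inj₂ d₁ | inj₂ d₂ | inj₁ d₃ = trans (memT-swap₁₂ C p q r) (trans (memT-swap₂₃ C q p r)
                                            (odd-triple q r p d₃ (trans (D-sym q p) d₁) (trans (D-sym r p) d₂)))
      ... | inj₁ d₁ | inj₁ d₂ | inj₁ d₃ = ⊥-elim (true≢false d₃ (not-three p q r d₁ d₂))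
      ... | inj₂ d₁ | inj₂ d₂ | inj₂ d₃ = ⊥-elim (true≢false odd (cong₂ _xor_ d₁ (cong₂ _xor_ d₂ d₃)))
      ... | inj₁ d₁ | inj₁ d₂ | inj₂ d₃ = ⊥-elim (true≢false odd (cong₂ _xor_ d₁ (cong₂ _xor_ d₂ d₃)))
      ... | inj₁ d₁ | inj₂ d₂ | inj₁ d₃ = ⊥-elim (true≢false odd (cong₂ _xor_ d₁ (cong₂ _xor_ d₂ d₃)))
      ... | inj₂ d₁ | inj₁ d₂ | inj₁ d₃ = ⊥-elim (true≢false odd (cong₂ _xor_ d₁ (cong₂ _xor_ d₂ d₃)))

    -- Take u₀, u₁, u₂ of colours 0, 1, 2.  The coboundary δ D contains xu₀u₁,
    -- hence meets every basis, so by minimality C ⊆ δ D; but xu₀u₂ ∈ C ∖ δ D.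
    impossible : ⊥
    impossible = true≢false (face-memT σ₀₂ (C⊆δD _ (face-∈ σ₀₂ xu₀u₂∈C))) xu₀u₂∉δD
      where
      u₀ = proj₁ (onto κ 0F)
      u₁ = proj₁ (onto κ 1F)
      u₂ = proj₁ (onto κ 2F)
      e₀ = proj₂ (onto κ 0F)
      e₁ = proj₂ (onto κ 1F)
      e₂ = proj₂ (onto κ 2F)
      σ₀₁ = sort x u₀ u₁ (≢-flip (coloured≢x e₀)) (other-colour e₀ e₁ (λ ())) (≢-flip (coloured≢x e₁))
      σ₀₂ = sort x u₀ u₂ (≢-flip (coloured≢x e₀)) (other-colour e₀ e₂ (λ ())) (≢-flip (coloured≢x e₂))
      δD-symmetric = δ-symmetric D-sym D-irrefl

      xu₀u₁∈δD : memT (δ D) x u₀ u₁ ≡ true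
      xu₀u₁∈δD = trans (memT-symmetric δD-symmetric x u₀ u₁) (cong₂ _xor_ (D-x u₀) (cong₂ _xor_ (D-x u₁) (D-01 e₀ e₁)))

      xu₀u₂∉δD : memT (δ D) x u₀ u₂ ≡ false
      xu₀u₂∉δD = trans (memT-symmetric δD-symmetric x u₀ u₂) (cong₂ _xor_ (D-x u₀) (cong₂ _xor_ (D-x u₂) D-02))
        where
        D-02 : D u₀ u₂ ≡ false
        D-02 rewrite e₀ | e₂ = refl

      xu₀u₂∈C : memT C x u₀ u₂ ≡ true
      xu₀u₂∈C = linked e₀ (coloured≢x e₂) (coloured∉S e₂) (other-colour e₂ e₀ (λ ())) (λ e → 2≢0 (trans (sym e₂) e))
        where
        2≢0 : ¬ just 2F ≡ just 0F
        2≢0 ()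

      C⊆δD : C ⊆ₜ δ D
      C⊆δD = hypercut-minimal hc δD⊆C λ T mT disj → coboundary-meets-bases D (face-∈ σ₀₁ xu₀u₁∈δD) mT disj

claim1 : (n : ℕ) (C : TSet n) → Hypercut C → (x : Fin n) (S A : Subset n) →
    x ∉ S → x ∉ A → (∀ u → u ∈ A → u ∉ S) → Σ (Fin n) (λ u → u ∈ A) →
    IsAtom C x S A →
    Σ (List (Fin n × Fin n)) (λ es → Unique es × All (EdgeG'MeetingA C x S A) es × (length es ≥ ∣ A ∣ ∸ 2))
claim1 n C hc x S A _ x∉A A∩S=∅ _ atom = conclude (few-edges⇒colouring edges 2)
  where
  open Main C hc x S A x∉A A∩S=∅ atom
  open Counting A
  conclude : length meeting ≥ ∣ A ∣ ∸ 2 ⊎ Σ (Colouring A 3) (λ κ → Respects κ edges) →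
             Σ (List (Fin n × Fin n)) (λ es → Unique es × All (EdgeG'MeetingA C x S A) es × (length es ≥ ∣ A ∣ ∸ 2))
  conclude (inj₁ many)       = meeting , meeting-unique , meeting-all , many
  conclude (inj₂ (κ , resp)) = ⊥-elim (ThreeColours.impossible κ resp)
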